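{- For primes $p>2$, \[Q(p,p)=-1+O\Big(\frac1p\Big).\]
   Context: For $t\in\mathbb{Z}$ let $E_t:y^2=x^3+tx^2-(t+3)x+1$. For an odd prime $p$ and $t\bmod p$, $\lambda_t(p)=-p^{ -1/2}\sum_{x\bmod p}\big(\frac{x^3+tx^2-(t+3)x+1}{p}\big)$ (Legendre symbol) and $\mu_t(p)=-\lambda_t(p)$. $Q(p,p)=\frac1p\sum_{t\bmod p}\lambda_t(p)\mu_t(p)$. The implied constant is absolute. -}

module Defs where

open import Data.Nat as ℕ using (ℕ; zero; suc)
open import Data.Integer as ℤ using (ℤ; +_; _%ℕ_)
open import Data.List using (List; map; upTo)
open import Data.Bool.ListAction using (any)
open import Data.Bool using (Bool; if_then_else_)
open import Data.Rational as ℚ using (ℚ; _/_)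

legendre : ℤ → (p : ℕ) → ℤ
legendre a zero = + 0
legendre a (suc k) =
  let r = a %ℕ suc k in
  if r ℕ.≡ᵇ 0 then + 0
  else if any (λ y → ((y ℕ.* y) ℕ.% suc k) ℕ.≡ᵇ r) (upTo (suc k)) then + 1
  else ℤ.-[1+ 0 ]

cubic : ℤ → ℤ → ℤ
cubic t x = x ℤ.* x ℤ.* x ℤ.+ t ℤ.* x ℤ.* x ℤ.- (t ℤ.+ + 3) ℤ.* x ℤ.+ + 1

-- a_t(p) = Σ_{x mod p} ((x^3+tx^2-(t+3)x+1)/p), so that λ_t(p) = - a_t(p) / √p.
a : ℤ → ℕ → ℤ
a t p = sum' (map (λ x → legendre (cubic t (+ x)) p) (upTo p))
  where
  sum' : List ℤ → ℤ
  sum' = Data.List.foldr ℤ._+_ (+ 0)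

-- Q(p,p) = (1/p) Σ_{t mod p} λ_t(p) μ_t(p) = -(1/p) Σ_t λ_t(p)^2 = -(1/p^2) Σ_t a_t(p)^2
-- (the value at p = 0 is an irrelevant junk value).
Q : ℕ → ℚ
Q zero = ℚ.0ℚ
Q (suc k) =
  ℚ.- ((Data.List.foldr ℤ._+_ (+ 0) (map (λ t → a (+ t) (suc k) ℤ.* a (+ t) (suc k)) (upTo (suc k))))
        / (suc k ℕ.* suc k))

module Submission where

-- Write the cubic as g x + h x t with g x = x³ - 3x + 1 and h x = x² - x, so that
-- a_t = Σₓ χ (g x + h x t) for the Legendre symbol χ, and -p² Q(p, p) = Σₜ a_t².
-- Expanding the square, Σₜ a_t² = Σ_{x,y} Σₜ χ ((g x + h x t)(g y + h y t)).  The inner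
-- correlation sum of two linear polynomials is evaluated exactly through Jacobsthal's sum
-- Σₛ χ (s (s + e)) = -1 (e ≢ 0): it equals - χ (h x) χ (h y) + p · mainTerm x y, where the
-- main term is nonzero only when both lines are constant or proportional.  Since
-- Σₓ χ (h x) = -1 this gives Σₜ a_t² = -1 + p Σ_{x,y} mainTerm x y.  For a regular x the
-- lines proportional to it are those through the orbit {x, 1/(1 - x), (x - 1)/x}, so its row
-- sum is 1 + χ (x - 1) + χ (- x) except at the at most four exceptional x (x ≡ 0, 1 or
-- x² - x + 1 ≡ 0), where the error is at most 5.  Hence Σₜ a_t² = -1 + p (p + E), ∣E∣ ≤ 20,
-- and ∣Q(p, p) + 1∣ · p ≤ 21.

open import Data.Nat as ℕ using (ℕ; zero; suc)
import Data.Nat.Properties as ℕP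
import Data.Nat.Divisibility as ℕD
import Data.Nat.DivMod as ℕDM
open import Data.Nat.Primality using (Prime; euclidsLemma)
open import Data.Nat.Coprimality using (prime⇒coprime; coprime-Bézout)
open import Data.Nat.GCD using (module Bézout)
open import Data.Integer as ℤ using (ℤ; +_; -[1+_]; _+_; _*_; _-_; -_; _≤_; _%ℕ_; _/ℕ_; _⊖_)
import Data.Integer.Properties as ℤP
open import Data.Integer.DivMod using (a≡a%ℕn+[a/ℕn]*n; n%ℕd<d)
open import Data.Integer.Divisibility.Signed as ℤD using (divides; ∣ᵤ⇒∣; ∣⇒∣ᵤ)
open import Data.Integer.Tactic.RingSolver using (solve-∀)
open import Data.Rational as ℚ using (ℚ; _/_; toℚᵘ; 1ℚ)
import Data.Rational.Properties as ℚP
open import Data.Rational.Unnormalised as ℚᵘ using (ℚᵘ; mkℚᵘ; *≤*)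
import Data.Rational.Unnormalised.Properties as ℚᵘP
open import Data.List using (map; foldr; applyUpTo; upTo)
open import Data.Bool using (Bool; true; false; if_then_else_; T; T?)
open import Data.Bool.ListAction using (any)
open import Data.List.Relation.Unary.Any.Properties using (any⁺; any⁻; applyUpTo⁺; applyUpTo⁻)
open import Data.Sum using (_⊎_; inj₁; inj₂; [_,_]) renaming (map to ⊎-map)
open import Data.Product using (Σ; ∃; _,_; proj₁; proj₂; _×_)
open import Data.Empty using (⊥; ⊥-elim)
open import Data.Unit using (tt)
open import Function using (_∘_)
open import Relation.Nullary using (Dec; yes; no; ¬_)
open import Relation.Nullary.Decidable using (map′; ¬?; _×-dec_; _⊎-dec_)
open import Relation.Binary.PropositionalEquality using (_≡_; refl; sym; trans; cong; cong₂; subst; subst₂; module ≡-Reasoning)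
open import Relation.Binary.Bundles using (Setoid)
import Relation.Binary.Reasoning.Setoid as SetoidReasoning
open import Defs using (legendre; cubic; a; Q)

Σ< : ℕ → (ℕ → ℤ) → ℤ
Σ< zero    f = + 0
Σ< (suc n) f = Σ< n f + f n

Σ-cong : ∀ n {f g : ℕ → ℤ} → (∀ x → x ℕ.< n → f x ≡ g x) → Σ< n f ≡ Σ< n g
Σ-cong zero    _  = refl
Σ-cong (suc n) eq = cong₂ _+_ (Σ-cong n (λ x x<n → eq x (ℕP.m<n⇒m<1+n x<n))) (eq n ℕP.≤-refl)

Σ-+ : ∀ n (f g : ℕ → ℤ) → Σ< n (λ x → f x + g x) ≡ Σ< n f + Σ< n g
Σ-+ zero    f g = refl
Σ-+ (suc n) f g = trans (cong (_+ (f n + g n)) (Σ-+ n f g)) (interchange (Σ< n f) (Σ< n g) (f n) (g n))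
  where
  interchange : ∀ a b c d → (a + b) + (c + d) ≡ (a + c) + (b + d)
  interchange = solve-∀

Σ-*ˡ : ∀ n c (f : ℕ → ℤ) → Σ< n (λ x → c * f x) ≡ c * Σ< n f
Σ-*ˡ zero    c f = sym (ℤP.*-zeroʳ c)
Σ-*ˡ (suc n) c f = trans (cong (_+ c * f n) (Σ-*ˡ n c f)) (sym (ℤP.*-distribˡ-+ c (Σ< n f) (f n)))

Σ-*ʳ : ∀ n c (f : ℕ → ℤ) → Σ< n (λ x → f x * c) ≡ Σ< n f * c
Σ-*ʳ n c f = trans (Σ-cong n (λ x _ → ℤP.*-comm (f x) c)) (trans (Σ-*ˡ n c f) (ℤP.*-comm c (Σ< n f)))

Σ-neg : ∀ n (f : ℕ → ℤ) → Σ< n (λ x → - f x) ≡ - Σ< n f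
Σ-neg zero    f = refl
Σ-neg (suc n) f = trans (cong (_+ - f n) (Σ-neg n f)) (sym (ℤP.neg-distrib-+ (Σ< n f) (f n)))

Σ-const : ∀ n c → Σ< n (λ _ → c) ≡ + n * c
Σ-const zero    c = refl
Σ-const (suc n) c = trans (cong (_+ c) (Σ-const n c)) (step (+ n) c)
  where
  step : ∀ m c → m * c + c ≡ (+ 1 + m) * c
  step = solve-∀

Σ-zero : ∀ n → Σ< n (λ _ → + 0) ≡ + 0
Σ-zero n = trans (Σ-const n (+ 0)) (ℤP.*-zeroʳ (+ n))

Σ-one : ∀ n → Σ< n (λ _ → + 1) ≡ + n
Σ-one n = trans (Σ-const n (+ 1)) (ℤP.*-identityʳ (+ n))

Σ-swap : ∀ m n (f : ℕ → ℕ → ℤ) →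
         Σ< m (λ x → Σ< n (λ y → f x y)) ≡ Σ< n (λ y → Σ< m (λ x → f x y))
Σ-swap zero    n f = sym (Σ-zero n)
Σ-swap (suc m) n f =
  trans (cong (_+ Σ< n (f m)) (Σ-swap m n f)) (sym (Σ-+ n (λ y → Σ< m (λ x → f x y)) (f m)))

-- Peeling off the first term; needed to compare with right-nested list sums.
Σ-shift : ∀ n (f : ℕ → ℤ) → Σ< (suc n) f ≡ f 0 + Σ< n (f ∘ suc)
Σ-shift zero    f = ℤP.+-comm (+ 0) (f 0)
Σ-shift (suc n) f = trans (cong (_+ f (suc n)) (Σ-shift n f)) (ℤP.+-assoc (f 0) _ _)

Σ-foldr : ∀ n (f : ℕ → ℤ) (g : ℕ → ℕ) → foldr _+_ (+ 0) (map f (applyUpTo g n)) ≡ Σ< n (f ∘ g)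
Σ-foldr zero    f g = refl
Σ-foldr (suc n) f g = trans (cong (_+_ (f (g 0))) (Σ-foldr n f (g ∘ suc))) (sym (Σ-shift n (f ∘ g)))

Σ-mono-≤ : ∀ n {f g : ℕ → ℤ} → (∀ x → x ℕ.< n → f x ≤ g x) → Σ< n f ≤ Σ< n g
Σ-mono-≤ zero    _   = ℤP.≤-refl
Σ-mono-≤ (suc n) f≤g = ℤP.+-mono-≤ (Σ-mono-≤ n (λ x x<n → f≤g x (ℕP.m<n⇒m<1+n x<n))) (f≤g n ℕP.≤-refl)

Σ-nonpos-zero : ∀ n (f : ℕ → ℤ) → (∀ x → x ℕ.< n → f x ≤ + 0) → Σ< n f ≡ + 0 →
                ∀ x → x ℕ.< n → f x ≡ + 0
Σ-nonpos-zero (suc n) f f≤0 sum≡0 x x<1+n = [ earlier , (λ { refl → last≡0 }) ] (ℕP.m<1+n⇒m<n∨m≡n x<1+n)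
  where
  init≤0 : Σ< n f ≤ + 0
  init≤0 = ℤP.≤-trans (Σ-mono-≤ n (λ y y<n → f≤0 y (ℕP.m<n⇒m<1+n y<n))) (ℤP.≤-reflexive (Σ-zero n))
  init≡-last : Σ< n f ≡ - f n
  init≡-last = trans (split (Σ< n f) (f n)) (trans (cong (_+_ (- f n)) sum≡0) (ℤP.+-identityʳ (- f n)))
    where
    split : ∀ a b → a ≡ - b + (a + b)
    split = solve-∀
  init≡0 : Σ< n f ≡ + 0
  init≡0 = ℤP.≤-antisym init≤0
             (ℤP.≤-trans (ℤP.neg-mono-≤ (f≤0 n ℕP.≤-refl)) (ℤP.≤-reflexive (sym init≡-last)))
  last≡0 : f n ≡ + 0
  last≡0 = trans (sym (ℤP.+-identityˡ (f n))) (trans (cong (_+ f n) (sym init≡0)) sum≡0)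
  earlier : x ℕ.< n → f x ≡ + 0
  earlier = Σ-nonpos-zero n f (λ y y<n → f≤0 y (ℕP.m<n⇒m<1+n y<n)) init≡0 x

𝟙 : ∀ {ℓ} {A : Set ℓ} → Dec A → ℤ
𝟙 (yes _) = + 1
𝟙 (no _)  = + 0

𝟙-yes : ∀ {ℓ} {A : Set ℓ} (d : Dec A) → A → 𝟙 d ≡ + 1
𝟙-yes (yes _) _ = refl
𝟙-yes (no ¬a) a = ⊥-elim (¬a a)

𝟙-no : ∀ {ℓ} {A : Set ℓ} (d : Dec A) → ¬ A → 𝟙 d ≡ + 0
𝟙-no (yes a) ¬a = ⊥-elim (¬a a)
𝟙-no (no _)  _  = refl

𝟙-iff : ∀ {ℓ ℓ′} {A : Set ℓ} {B : Set ℓ′} (d : Dec A) (e : Dec B) → (A → B) → (B → A) → 𝟙 d ≡ 𝟙 e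
𝟙-iff (yes a) e f g = sym (𝟙-yes e (f a))
𝟙-iff (no ¬a) e f g = sym (𝟙-no e (λ b → ¬a (g b)))

𝟙-disjoint : ∀ {A B C : Set} (d : Dec A) (e₁ : Dec B) (e₂ : Dec C) →
             (A → B ⊎ C) → (B → A) → (C → A) → (B → C → ⊥) → 𝟙 d ≡ 𝟙 e₁ + 𝟙 e₂
𝟙-disjoint (yes a)  (yes b) (yes c) _ _ _ disj = ⊥-elim (disj b c)
𝟙-disjoint (yes a)  (yes b) (no _)  _ _ _ _    = refl
𝟙-disjoint (yes a)  (no _)  (yes c) _ _ _ _    = refl
𝟙-disjoint (yes a)  (no ¬b) (no ¬c) f _ _ _    = ⊥-elim ([ ¬b , ¬c ] (f a))
𝟙-disjoint (no ¬a)  (yes b) _       _ g _ _    = ⊥-elim (¬a (g b))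
𝟙-disjoint (no ¬a)  (no _)  (yes c) _ _ h _    = ⊥-elim (¬a (h c))
𝟙-disjoint (no _)   (no _)  (no _)  _ _ _ _    = refl

𝟙≥0 : ∀ {A : Set} (d : Dec A) → + 0 ≤ 𝟙 d
𝟙≥0 (yes _) = ℤ.+≤+ ℕ.z≤n
𝟙≥0 (no _)  = ℤP.≤-refl

𝟙-cover : ∀ {A B C : Set} (d : Dec A) (e₁ : Dec B) (e₂ : Dec C) → (A → B ⊎ C) → 𝟙 d ≤ 𝟙 e₁ + 𝟙 e₂
𝟙-cover (no _)  e₁      e₂      _ = ℤP.+-mono-≤ (𝟙≥0 e₁) (𝟙≥0 e₂)
𝟙-cover (yes _) (yes _) e₂      _ = ℤP.+-mono-≤ (ℤP.≤-refl {+ 1}) (𝟙≥0 e₂)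
𝟙-cover (yes _) (no _)  (yes _) _ = ℤP.≤-refl
𝟙-cover (yes a) (no ¬b) (no ¬c) f = ⊥-elim ([ ¬b , ¬c ] (f a))

𝟙-scaled : ∀ {A : Set} c (d : Dec A) → -[1+ 0 ] ≤ c → c ≤ + 1 → (- 𝟙 d ≤ c * 𝟙 d) × (c * 𝟙 d ≤ 𝟙 d)
𝟙-scaled c (yes _) lo hi = subst (- + 1 ≤_) (sym (ℤP.*-identityʳ c)) lo , subst (_≤ + 1) (sym (ℤP.*-identityʳ c)) hi
𝟙-scaled c (no _)  _  _  = ℤP.≤-reflexive (sym (ℤP.*-zeroʳ c)) , ℤP.≤-reflexive (ℤP.*-zeroʳ c)

Σ-delta : ∀ n r (f : ℕ → ℤ) → r ℕ.< n → Σ< n (λ x → 𝟙 (x ℕ.≟ r) * f x) ≡ f r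
Σ-delta (suc n) r f r<1+n with ℕP.m<1+n⇒m<n∨m≡n r<1+n
... | inj₁ r<n  = trans (cong₂ _+_ (Σ-delta n r f r<n) last≡0) (ℤP.+-identityʳ (f r))
  where
  last≡0 : 𝟙 (n ℕ.≟ r) * f n ≡ + 0
  last≡0 = trans (cong (_* f n) (𝟙-no (n ℕ.≟ r) (λ n≡r → ℕP.<-irrefl (sym n≡r) r<n))) (ℤP.*-zeroˡ (f n))
... | inj₂ refl = trans (cong₂ _+_ init≡0 (cong (_* f r) (𝟙-yes (r ℕ.≟ r) refl)))
                        (trans (ℤP.+-identityˡ _) (ℤP.*-identityˡ (f r)))
  where
  init≡0 : Σ< r (λ x → 𝟙 (x ℕ.≟ r) * f x) ≡ + 0
  init≡0 = trans (Σ-cong r (λ x x<r → trans (cong (_* f x) (𝟙-no (x ℕ.≟ r) (λ x≡r → ℕP.<-irrefl x≡r x<r)))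
                                            (ℤP.*-zeroˡ (f x))))
                 (Σ-zero r)

-- From the exact integer identity to the rational inequality of the theorem:
-- if S = -1 + p (p + E) with ∣E∣ ≤ B, then ∣1 - S/p²∣ · p = ∣1 - p E∣ / p ≤ B + 1.

/≃mkℚᵘ : ∀ i d → toℚᵘ (i / suc d) ℚᵘ.≃ mkℚᵘ i d
/≃mkℚᵘ i d = ℚP.toℚᵘ-fromℚᵘ (mkℚᵘ i d)

module _ (k : ℕ) (S E : ℤ) (B : ℕ) where
  private
    p : ℕ
    p = suc k

  deviationᵘ : ℚᵘ
  deviationᵘ = ℚᵘ.∣ ℚᵘ.- (S ℚᵘ./ (p ℕ.* p)) ℚᵘ.+ ℚᵘ.1ℚᵘ ∣ ℚᵘ.* ((+ p) ℚᵘ./ 1)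

  deviationᵘ≃ : toℚᵘ (ℚ.∣ ℚ.- (S / (p ℕ.* p)) ℚ.+ 1ℚ ∣ ℚ.* ((+ p) / 1)) ℚᵘ.≃ deviationᵘ
  deviationᵘ≃ = begin
    toℚᵘ (ℚ.∣ ℚ.- q ℚ.+ 1ℚ ∣ ℚ.* ((+ p) / 1))
      ≈⟨ ℚP.toℚᵘ-homo-* ℚ.∣ ℚ.- q ℚ.+ 1ℚ ∣ ((+ p) / 1) ⟩
    toℚᵘ ℚ.∣ ℚ.- q ℚ.+ 1ℚ ∣ ℚᵘ.* toℚᵘ ((+ p) / 1)
      ≈⟨ ℚᵘP.*-cong (ℚP.toℚᵘ-homo-∣-∣ (ℚ.- q ℚ.+ 1ℚ)) (/≃mkℚᵘ (+ p) 0) ⟩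
    ℚᵘ.∣ toℚᵘ (ℚ.- q ℚ.+ 1ℚ) ∣ ℚᵘ.* mkℚᵘ (+ p) 0
      ≈⟨ ℚᵘP.*-cong (ℚᵘP.∣-∣-cong (ℚP.toℚᵘ-homo-+ (ℚ.- q) 1ℚ)) (ℚᵘP.≃-refl {mkℚᵘ (+ p) 0}) ⟩
    ℚᵘ.∣ toℚᵘ (ℚ.- q) ℚᵘ.+ toℚᵘ 1ℚ ∣ ℚᵘ.* mkℚᵘ (+ p) 0
      ≈⟨ ℚᵘP.*-cong (ℚᵘP.∣-∣-cong (ℚᵘP.+-cong (ℚᵘP.≃-trans (ℚP.toℚᵘ-homo‿- q) (ℚᵘP.-‿cong (/≃mkℚᵘ S (k ℕ.+ k ℕ.* p))))
                                               (ℚᵘP.≃-refl {ℚᵘ.1ℚᵘ})))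
                    (ℚᵘP.≃-refl {mkℚᵘ (+ p) 0}) ⟩
    deviationᵘ ∎
    where
    open ℚᵘP.≃-Reasoning
    q : ℚ
    q = S / (p ℕ.* p)

  module _ (S≡ : S ≡ -[1+ 0 ] + + p * (+ p + E)) (∣E∣≤B : ℤ.∣ E ∣ ℕ.≤ B) where
    -- the numerator of 1 - S/p² is 1 - p E, whose absolute value is at most p (B + 1)
    numerator≤ : ℤ.∣ - S * + 1 + + 1 * + (p ℕ.* p) ∣ ℕ.≤ suc B ℕ.* p
    numerator≤ = begin
      ℤ.∣ - S * + 1 + + 1 * + (p ℕ.* p) ∣
        ≡⟨ cong ℤ.∣_∣ (trans (cong (λ w → - S * + 1 + + 1 * w) (sym (ℤP.pos-* p p))) (cancel S (+ p) S≡)) ⟩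
      ℤ.∣ + 1 - + p * E ∣    ≤⟨ ℤP.∣i-j∣≤∣i∣+∣j∣ (+ 1) (+ p * E) ⟩
      1 ℕ.+ ℤ.∣ + p * E ∣    ≡⟨ cong (1 ℕ.+_) (ℤP.abs-* (+ p) E) ⟩
      1 ℕ.+ p ℕ.* ℤ.∣ E ∣    ≤⟨ ℕP.+-mono-≤ {1} {p} (ℕ.s≤s ℕ.z≤n) (ℕP.*-monoʳ-≤ p ∣E∣≤B) ⟩
      p ℕ.+ p ℕ.* B          ≡⟨ cong (p ℕ.+_) (ℕP.*-comm p B) ⟩
      suc B ℕ.* p ∎
      where
      open ℕP.≤-Reasoning
      cancel : ∀ S P → S ≡ -[1+ 0 ] + P * (P + E) → - S * + 1 + + 1 * (P * P) ≡ + 1 - P * E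
      cancel _ P refl = identity P E
        where
        identity : ∀ P E → - (-[1+ 0 ] + P * (P + E)) * + 1 + + 1 * (P * P) ≡ + 1 - P * E
        identity = solve-∀

    deviationᵘ≤ : deviationᵘ ℚᵘ.≤ (+ suc B ℚᵘ./ 1)
    deviationᵘ≤ = *≤* (subst₂ _≤_ (sym lhs) (sym rhs) (ℤ.+≤+ (ℕP.*-monoˡ-≤ p numerator≤)))
      where
      lhs : ℚᵘ.numerator deviationᵘ * + 1 ≡ + (ℤ.∣ - S * + 1 + + 1 * + (p ℕ.* p) ∣ ℕ.* p)
      lhs = trans (ℤP.*-identityʳ _) (sym (ℤP.pos-* ℤ.∣ - S * + 1 + + 1 * + (p ℕ.* p) ∣ p))
      rhs : + suc B * + (p ℕ.* p ℕ.* 1 ℕ.* 1) ≡ + (suc B ℕ.* p ℕ.* p)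
      rhs = trans (sym (ℤP.pos-* (suc B) (p ℕ.* p ℕ.* 1 ℕ.* 1)))
                  (cong +_ (trans (cong (suc B ℕ.*_) (trans (ℕP.*-identityʳ (p ℕ.* p ℕ.* 1)) (ℕP.*-identityʳ (p ℕ.* p))))
                                  (sym (ℕP.*-assoc (suc B) p p))))

    deviation-bound : ℚ.∣ ℚ.- (S / (p ℕ.* p)) ℚ.+ 1ℚ ∣ ℚ.* ((+ p) / 1) ℚ.≤ (+ suc B) / 1
    deviation-bound = ℚP.toℚᵘ-cancel-≤ (ℚᵘP.≤-respʳ-≃ (ℚᵘP.≃-sym (/≃mkℚᵘ (+ suc B) 0))
                                         (ℚᵘP.≤-respˡ-≃ (ℚᵘP.≃-sym deviationᵘ≃) deviationᵘ≤))

module Residues (k : ℕ) where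

  p : ℕ
  p = suc k

  P : ℤ
  P = + p

  infix 4 _≈_
  record _≈_ (a b : ℤ) : Set where
    constructor mk
    field divides-difference : P ℤD.∣ (a - b)

  p∣_ : ℤ → Set
  p∣ a = a ≈ + 0

  ≈-refl : ∀ {a} → a ≈ a
  ≈-refl {a} = mk (divides (+ 0) (ℤP.+-inverseʳ a))

  ≡⇒≈ : ∀ {a b} → a ≡ b → a ≈ b
  ≡⇒≈ refl = ≈-refl

  ≈-sym : ∀ {a b} → a ≈ b → b ≈ a
  ≈-sym {a} {b} (mk d) = mk (subst (P ℤD.∣_) (sym (swap a b)) (ℤD.∣m⇒∣-m d))
    where
    swap : ∀ a b → b - a ≡ - (a - b)
    swap = solve-∀

  ≈-trans : ∀ {a b c} → a ≈ b → b ≈ c → a ≈ c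
  ≈-trans {a} {b} {c} (mk d₁) (mk d₂) = mk (subst (P ℤD.∣_) (sym (telescope a b c)) (ℤD.∣m∣n⇒∣m+n d₁ d₂))
    where
    telescope : ∀ a b c → a - c ≡ (a - b) + (b - c)
    telescope = solve-∀

  ≈-setoid : Setoid _ _
  ≈-setoid = record { Carrier = ℤ ; _≈_ = _≈_ ; isEquivalence = record { refl = ≈-refl ; sym = ≈-sym ; trans = ≈-trans } }

  module ≈-Reasoning = SetoidReasoning ≈-setoid

  +-cong : ∀ {a b c d} → a ≈ b → c ≈ d → a + c ≈ b + d
  +-cong {a} {b} {c} {d} (mk d₁) (mk d₂) = mk (subst (P ℤD.∣_) (sym (regroup a b c d)) (ℤD.∣m∣n⇒∣m+n d₁ d₂))
    where
    regroup : ∀ a b c d → (a + c) - (b + d) ≡ (a - b) + (c - d)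
    regroup = solve-∀

  *-cong : ∀ {a b c d} → a ≈ b → c ≈ d → a * c ≈ b * d
  *-cong {a} {b} {c} {d} (mk d₁) (mk d₂) =
    mk (subst (P ℤD.∣_) (sym (regroup a b c d)) (ℤD.∣m∣n⇒∣m+n (ℤD.∣m⇒∣m*n c d₁) (ℤD.∣n⇒∣m*n b d₂)))
    where
    regroup : ∀ a b c d → (a * c) - (b * d) ≡ (a - b) * c + b * (c - d)
    regroup = solve-∀

  neg-cong : ∀ {a b} → a ≈ b → - a ≈ - b
  neg-cong {a} {b} (mk d) = mk (subst (P ℤD.∣_) (sym (regroup a b)) (ℤD.∣m⇒∣-m d))
    where
    regroup : ∀ a b → (- a) - (- b) ≡ - (a - b)
    regroup = solve-∀

  +-congˡ : ∀ c {a b} → a ≈ b → c + a ≈ c + b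
  +-congˡ c = +-cong (≈-refl {c})

  +-congʳ : ∀ c {a b} → a ≈ b → a + c ≈ b + c
  +-congʳ c a≈b = +-cong a≈b (≈-refl {c})

  *-congˡ : ∀ c {a b} → a ≈ b → c * a ≈ c * b
  *-congˡ c = *-cong (≈-refl {c})

  *-congʳ : ∀ c {a b} → a ≈ b → a * c ≈ b * c
  *-congʳ c a≈b = *-cong a≈b (≈-refl {c})

  p∣-diff⇒≈ : ∀ {a b} → p∣ (a - b) → a ≈ b
  p∣-diff⇒≈ {a} {b} p∣a-b = begin
    a             ≡⟨ split a b ⟩
    (a - b) + b   ≈⟨ +-congʳ b p∣a-b ⟩
    + 0 + b       ≡⟨ ℤP.+-identityˡ b ⟩
    b             ∎
    where
    open ≈-Reasoning
    split : ∀ a b → a ≡ (a - b) + b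
    split = solve-∀

  ≈⇒p∣-diff : ∀ {a b} → a ≈ b → p∣ (a - b)
  ≈⇒p∣-diff {a} {b} a≈b = begin
    a - b  ≈⟨ +-congʳ (- b) a≈b ⟩
    b - b  ≡⟨ ℤP.+-inverseʳ b ⟩
    + 0    ∎
    where open ≈-Reasoning

  p∣-resp-≡ : ∀ {a b} → a ≡ b → p∣ a → p∣ b
  p∣-resp-≡ refl p∣a = p∣a

  p∣*ˡ : ∀ {a} b → p∣ a → p∣ (a * b)
  p∣*ˡ {a} b p∣a = ≈-trans (*-congʳ b p∣a) (≡⇒≈ (ℤP.*-zeroˡ b))

  p∣*ʳ : ∀ a {b} → p∣ b → p∣ (a * b)
  p∣*ʳ a {b} p∣b = ≈-trans (*-congˡ a p∣b) (≡⇒≈ (ℤP.*-zeroʳ a))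

  ≈-mod : ∀ a → a ≈ + (a %ℕ p)
  ≈-mod a = mk (divides (a /ℕ p) (begin
      a - + (a %ℕ p)                           ≡⟨ cong (_- + (a %ℕ p)) (a≡a%ℕn+[a/ℕn]*n a p) ⟩
      (+ (a %ℕ p) + (a /ℕ p) * P) - + (a %ℕ p)  ≡⟨ cancel (+ (a %ℕ p)) ((a /ℕ p) * P) ⟩
      (a /ℕ p) * P                             ∎))
    where
    open ≡-Reasoning
    cancel : ∀ x y → (x + y) - x ≡ y
    cancel = solve-∀

  residue-unique : ∀ {m n} → m ℕ.< p → n ℕ.< p → + m ≈ + n → m ≡ n
  residue-unique {m} {n} m<p n<p (mk d) = ℤP.+-injective (ℤP.i-j≡0⇒i≡j (+ m) (+ n)
      (trans (ℤP.[+m]-[+n]≡m⊖n m n) (ℤP.∣i∣≡0⇒i≡0 (small-multiple (distance<p m n m<p n<p)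
        (subst (λ z → p ℕD.∣ ℤ.∣ z ∣) (ℤP.[+m]-[+n]≡m⊖n m n) (∣⇒∣ᵤ d))))))
    where
    distance<p : ∀ m n → m ℕ.< p → n ℕ.< p → ℤ.∣ m ⊖ n ∣ ℕ.< p
    distance<p m n m<p n<p with ℕP.≤-total m n
    ... | inj₁ m≤n = subst (ℕ._< p) (sym (ℤP.∣⊖∣-≤ m≤n)) (ℕP.≤-<-trans (ℕP.m∸n≤m n m) n<p)
    ... | inj₂ n≤m = subst (ℕ._< p) (sym (trans (ℤP.∣m⊖n∣≡∣n⊖m∣ m n) (ℤP.∣⊖∣-≤ n≤m)))
                           (ℕP.≤-<-trans (ℕP.m∸n≤m m n) m<p)
    small-multiple : ∀ {x} → x ℕ.< p → p ℕD.∣ x → x ≡ 0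
    small-multiple {zero}  _   _   = refl
    small-multiple {suc x} x<p p∣x = ⊥-elim (ℕP.<⇒≱ x<p (ℕD.∣⇒≤ p∣x))

  ≈⇒% : ∀ {a b} → a ≈ b → a %ℕ p ≡ b %ℕ p
  ≈⇒% {a} {b} a≈b = residue-unique (n%ℕd<d a p) (n%ℕd<d b p) (≈-trans (≈-sym (≈-mod a)) (≈-trans a≈b (≈-mod b)))

  %⇒≈ : ∀ {a b} → a %ℕ p ≡ b %ℕ p → a ≈ b
  %⇒≈ {a} {b} eq = ≈-trans (≈-mod a) (subst (λ z → + z ≈ b) (sym eq) (≈-sym (≈-mod b)))

  infix 4 _≈?_
  opaque
    _≈?_ : ∀ a b → Dec (a ≈ b)
    a ≈? b = map′ %⇒≈ ≈⇒% (a %ℕ p ℕ.≟ b %ℕ p)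

  p∣? : ∀ a → Dec (p∣ a)
  p∣? a = a ≈? + 0

  Σₚ : (ℤ → ℤ) → ℤ
  Σₚ f = Σ< p (λ x → f (+ x))

  Respects≈ : (ℤ → ℤ) → Set
  Respects≈ f = ∀ {a b} → a ≈ b → f a ≡ f b

  Σₚ-cong : ∀ {f g : ℤ → ℤ} → (∀ x → f x ≡ g x) → Σₚ f ≡ Σₚ g
  Σₚ-cong eq = Σ-cong p (λ x _ → eq (+ x))

  ⟦_≈_⟧ : ℤ → ℤ → ℤ
  ⟦ a ≈ b ⟧ = 𝟙 (a ≈? b)

  ⟦⟧-sym : ∀ a b → ⟦ a ≈ b ⟧ ≡ ⟦ b ≈ a ⟧
  ⟦⟧-sym a b = 𝟙-iff (a ≈? b) (b ≈? a) ≈-sym ≈-sym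

  ⟦⟧-cong : ∀ {a b c d} → a ≈ c → b ≈ d → ⟦ a ≈ b ⟧ ≡ ⟦ c ≈ d ⟧
  ⟦⟧-cong {a} {b} {c} {d} a≈c b≈d = 𝟙-iff (a ≈? b) (c ≈? d)
    (λ a≈b → ≈-trans (≈-sym a≈c) (≈-trans a≈b b≈d)) (λ c≈d → ≈-trans a≈c (≈-trans c≈d (≈-sym b≈d)))

  Σₚ-delta : ∀ (F : ℤ → ℤ) → Respects≈ F → ∀ c → Σₚ (λ x → ⟦ x ≈ c ⟧ * F x) ≡ F c
  Σₚ-delta F F-resp c =
    trans (Σ-cong p (λ x x<p → cong (_* F (+ x)) (𝟙-iff ((+ x) ≈? c) (x ℕ.≟ c %ℕ p) (to x x<p) (from x))))
          (trans (Σ-delta p (c %ℕ p) (λ x → F (+ x)) (n%ℕd<d c p)) (F-resp (≈-sym (≈-mod c))))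
    where
    to : ∀ x → x ℕ.< p → + x ≈ c → x ≡ c %ℕ p
    to x x<p x≈c = trans (sym (ℕDM.m<n⇒m%n≡m x<p)) (≈⇒% x≈c)
    from : ∀ x → x ≡ c %ℕ p → + x ≈ c
    from x refl = ≈-sym (≈-mod c)

  class-size : ∀ c → Σₚ (λ x → ⟦ x ≈ c ⟧) ≡ + 1
  class-size c = trans (Σₚ-cong (λ x → sym (ℤP.*-identityʳ ⟦ x ≈ c ⟧))) (Σₚ-delta (λ _ → + 1) (λ _ → refl) c)

  -- If a is a unit with inverse a′, then x ↦ a x + b permutes the residues, so sums of
  -- congruence-invariant functions are unchanged by this substitution.
  module _ {a a′ : ℤ} (inverse : a * a′ ≈ + 1) where
    affine-solve : ∀ {b u x} → u ≈ a * x + b → x ≈ a′ * (u - b)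
    affine-solve {b} {u} {x} u≈ax+b = begin
      x                        ≡⟨ sym (ℤP.*-identityˡ x) ⟩
      + 1 * x                  ≈⟨ *-congʳ x (≈-sym inverse) ⟩
      (a * a′) * x             ≡⟨ reassoc a a′ x b ⟩
      a′ * ((a * x + b) - b)   ≈⟨ *-congˡ a′ (+-congʳ (- b) (≈-sym u≈ax+b)) ⟩
      a′ * (u - b)             ∎
      where
      open ≈-Reasoning
      reassoc : ∀ a a′ x b → (a * a′) * x ≡ a′ * ((a * x + b) - b)
      reassoc = solve-∀

    affine-unsolve : ∀ {b u x} → x ≈ a′ * (u - b) → u ≈ a * x + b
    affine-unsolve {b} {u} {x} x≈ = begin
      u                         ≡⟨ reassoc u b ⟩
      + 1 * (u - b) + b         ≈⟨ +-congʳ b (*-congʳ (u - b) (≈-sym inverse)) ⟩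
      (a * a′) * (u - b) + b    ≡⟨ reassoc′ a a′ u b ⟩
      a * (a′ * (u - b)) + b    ≈⟨ +-congʳ b (*-congˡ a (≈-sym x≈)) ⟩
      a * x + b                 ∎
      where
      open ≈-Reasoning
      reassoc : ∀ u b → u ≡ + 1 * (u - b) + b
      reassoc = solve-∀
      reassoc′ : ∀ a a′ u b → (a * a′) * (u - b) + b ≡ a * (a′ * (u - b)) + b
      reassoc′ = solve-∀

    reindex : ∀ b (G : ℤ → ℤ) → Respects≈ G → Σₚ (λ x → G (a * x + b)) ≡ Σₚ G
    reindex b G G-resp = begin
      Σₚ (λ x → G (a * x + b))
        ≡⟨ Σₚ-cong (λ x → sym (Σₚ-delta G G-resp (a * x + b))) ⟩
      Σ< p (λ x → Σₚ (λ u → ⟦ u ≈ a * + x + b ⟧ * G u))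
        ≡⟨ Σ-swap p p _ ⟩
      Σ< p (λ u → Σₚ (λ x → ⟦ + u ≈ a * x + b ⟧ * G (+ u)))
        ≡⟨ Σ-cong p (λ u _ → Σ-*ʳ p (G (+ u)) _) ⟩
      Σ< p (λ u → Σₚ (λ x → ⟦ + u ≈ a * x + b ⟧) * G (+ u))
        ≡⟨ Σ-cong p (λ u _ → cong (_* G (+ u)) (trans (Σₚ-cong (λ x → 𝟙-iff (+ u ≈? a * x + b) (x ≈? a′ * (+ u - b))
                                                                               affine-solve affine-unsolve))
                                                         (class-size _))) ⟩
      Σ< p (λ u → + 1 * G (+ u))
        ≡⟨ Σ-cong p (λ u _ → ℤP.*-identityˡ _) ⟩
      Σₚ G ∎
      where open ≡-Reasoning

module OddPrime (k : ℕ) (isPrime : Prime (suc k)) (p>2 : 2 ℕ.< suc k) where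

  open Residues k public

  p∣⇒∣ : ∀ {a} → p∣ a → p ℕD.∣ ℤ.∣ a ∣
  p∣⇒∣ {a} (mk d) = subst (λ z → p ℕD.∣ ℤ.∣ z ∣) (ℤP.+-identityʳ a) (∣⇒∣ᵤ d)

  ∣⇒p∣ : ∀ {a} → p ℕD.∣ ℤ.∣ a ∣ → p∣ a
  ∣⇒p∣ {a} d = mk (subst (P ℤD.∣_) (sym (ℤP.+-identityʳ a)) (∣ᵤ⇒∣ d))

  euclid : ∀ {a b} → p∣ (a * b) → p∣ a ⊎ p∣ b
  euclid {a} {b} p∣ab = ⊎-map ∣⇒p∣ ∣⇒p∣ (euclidsLemma ℤ.∣ a ∣ ℤ.∣ b ∣ isPrime (subst (p ℕD.∣_) (ℤP.abs-* a b) (p∣⇒∣ p∣ab)))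

  p∤* : ∀ {a b} → ¬ p∣ a → ¬ p∣ b → ¬ p∣ (a * b)
  p∤* p∤a p∤b p∣ab = [ p∤a , p∤b ] (euclid p∣ab)

  p∤1 : ¬ p∣ (+ 1)
  p∤1 p∣1 = ℕP.<⇒≱ p>2 (ℕP.≤-trans (ℕD.∣⇒≤ (p∣⇒∣ {+ 1} p∣1)) (ℕ.s≤s ℕ.z≤n))

  p∤2 : ¬ p∣ (+ 2)
  p∤2 p∣2 = ℕP.<⇒≱ p>2 (ℕD.∣⇒≤ (p∣⇒∣ {+ 2} p∣2))

  p∤-1 : ¬ p∣ -[1+ 0 ]
  p∤-1 p∣-1 = p∤1 (neg-cong p∣-1)

  -- Every non-multiple of p has an inverse modulo p (Bézout for the residue and p).
  opaque
    inverse : ∀ a → ¬ p∣ a → Σ ℤ λ b → a * b ≈ + 1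
    inverse a p∤a = from-bezout (coprime-Bézout (prime⇒coprime isPrime {{residue≢0}} (n%ℕd<d a p)))
      where
      m : ℕ
      m = a %ℕ p
      residue≢0 : ℕ.NonZero m
      residue≢0 with a %ℕ p in eq
      ... | zero  = ⊥-elim (p∤a (%⇒≈ eq))
      ... | suc _ = _
      lift : ∀ {u v w z} → 1 ℕ.+ u ℕ.* v ≡ w ℕ.* z → + 1 + + u * + v ≡ + w * + z
      lift {u} {v} {w} {z} eq = trans (cong (_+_ (+ 1)) (sym (ℤP.pos-* u v))) (trans (cong +_ eq) (ℤP.pos-* w z))
      inverse-of-residue : ∀ b → + m * b ≈ + 1 → Σ ℤ λ b → a * b ≈ + 1
      inverse-of-residue b mb≈1 = b , ≈-trans (*-congʳ b (≈-mod a)) mb≈1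
      from-bezout : Bézout.Identity 1 p m → Σ ℤ λ b → a * b ≈ + 1
      from-bezout (Bézout.+- x y eq) =
        inverse-of-residue (- + y) (mk (divides (- + x) (trans (rearrange (+ m) (+ y)) (trans (cong -_ (lift {y} {m} {x} {p} eq)) (ℤP.neg-distribˡ-* (+ x) P)))))
        where
        rearrange : ∀ m y → m * (- y) - + 1 ≡ - (+ 1 + y * m)
        rearrange = solve-∀
      from-bezout (Bézout.-+ x y eq) =
        inverse-of-residue (+ y) (mk (divides (+ x) (trans (rearrange (+ m) (+ y)) (trans (cong (_- + 1) (sym (lift {x} {p} {y} {m} eq))) (cancel (+ x * P))))))
        where
        rearrange : ∀ m y → m * y - + 1 ≡ y * m - + 1
        rearrange = solve-∀
        cancel : ∀ z → (+ 1 + z) - + 1 ≡ z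
        cancel = solve-∀

  reindex-unit : ∀ a b → ¬ p∣ a → (G : ℤ → ℤ) → Respects≈ G → Σₚ (λ x → G (a * x + b)) ≡ Σₚ G
  reindex-unit a b p∤a = reindex {a} {proj₁ (inverse a p∤a)} (proj₂ (inverse a p∤a)) b

  cancel-≈ : ∀ {a y z} → ¬ p∣ a → a * y ≈ a * z → y ≈ z
  cancel-≈ {a} {y} {z} p∤a ay≈az =
    [ (λ p∣a → ⊥-elim (p∤a p∣a)) , p∣-diff⇒≈ ] (euclid (≈-trans (≡⇒≈ (distrib a y z)) (≈⇒p∣-diff ay≈az)))
    where
    distrib : ∀ a y z → a * (y - z) ≡ a * y - a * z
    distrib = solve-∀

  IsSquare : ℤ → Set
  IsSquare a = Σ ℤ λ y → y * y ≈ a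

  private
    squareTest : ℕ → ℕ → Bool
    squareTest r y = ((y ℕ.* y) ℕ.% p) ℕ.≡ᵇ r

    -- the definition of the Legendre symbol in Defs, as a function of the residue
    symbolOfResidue : ℕ → ℤ
    symbolOfResidue r = if r ℕ.≡ᵇ 0 then + 0
                        else if any (squareTest r) (upTo p) then + 1
                        else -[1+ 0 ]

  opaque
    χ : ℤ → ℤ
    χ a = legendre a p

    χ-residue : ∀ a → χ a ≡ symbolOfResidue (a %ℕ p)
    χ-residue a = refl

    legendre≡χ : ∀ a → legendre a p ≡ χ a
    legendre≡χ a = refl

  χ-resp : Respects≈ χ
  χ-resp {a} {b} a≈b = trans (χ-residue a) (trans (cong symbolOfResidue (≈⇒% a≈b)) (sym (χ-residue b)))

  private
    search⇒IsSquare : ∀ a → T (any (squareTest (a %ℕ p)) (upTo p)) → IsSquare a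
    search⇒IsSquare a found with applyUpTo⁻ (λ y → y) (any⁻ (squareTest (a %ℕ p)) (upTo p) found)
    ... | y , _ , test = + y , %⇒≈ (trans (cong (_%ℕ p) (sym (ℤP.pos-* y y))) (ℕP.≡ᵇ⇒≡ _ _ test))

    IsSquare⇒search : ∀ a → IsSquare a → T (any (squareTest (a %ℕ p)) (upTo p))
    IsSquare⇒search a (y , y²≈a) = any⁺ (squareTest (a %ℕ p)) (applyUpTo⁺ (λ y → y) test (n%ℕd<d y p))
      where
      r = y %ℕ p
      test : T (squareTest (a %ℕ p) r)
      test = ℕP.≡⇒≡ᵇ _ _ (trans (cong (_%ℕ p) (ℤP.pos-* r r)) (≈⇒% (≈-trans (*-cong (≈-sym (≈-mod y)) (≈-sym (≈-mod y))) y²≈a)))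

    if-true : ∀ {b} {x y : ℤ} → T b → (if b then x else y) ≡ x
    if-true {true} _ = refl

    if-false : ∀ {b} {x y : ℤ} → ¬ T b → (if b then x else y) ≡ y
    if-false {false} _ = refl
    if-false {true}  ¬t = ⊥-elim (¬t tt)

    symbolOfNonzero : ∀ r → ¬ r ≡ 0 → symbolOfResidue r ≡ (if any (squareTest r) (upTo p) then + 1 else -[1+ 0 ])
    symbolOfNonzero zero    r≢0 = ⊥-elim (r≢0 refl)
    symbolOfNonzero (suc r) _   = refl

  data Class (a : ℤ) : Set where
    divisible   : p∣ a → χ a ≡ + 0 → Class a
    residue     : ¬ p∣ a → IsSquare a → χ a ≡ + 1 → Class a
    nonresidue  : ¬ p∣ a → ¬ IsSquare a → χ a ≡ -[1+ 0 ] → Class a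

  classify : ∀ a → Class a
  classify a with a %ℕ p ℕ.≟ 0
  ... | yes r≡0 = divisible (%⇒≈ r≡0) (trans (χ-residue a) (cong symbolOfResidue r≡0))
  ... | no r≢0 with T? (any (squareTest (a %ℕ p)) (upTo p))
  ...   | yes found = residue (λ p∣a → r≢0 (≈⇒% p∣a)) (search⇒IsSquare a found)
                              (trans (χ-residue a) (trans (symbolOfNonzero _ r≢0) (if-true found)))
  ...   | no ¬found = nonresidue (λ p∣a → r≢0 (≈⇒% p∣a)) (λ sq → ¬found (IsSquare⇒search a sq))
                                 (trans (χ-residue a) (trans (symbolOfNonzero _ r≢0) (if-false ¬found)))

  χ-p∣ : ∀ {a} → p∣ a → χ a ≡ + 0
  χ-p∣ {a} p∣a with classify a
  ... | divisible _ χa≡0    = χa≡0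
  ... | residue p∤a _ _     = ⊥-elim (p∤a p∣a)
  ... | nonresidue p∤a _ _  = ⊥-elim (p∤a p∣a)

  χ-square : ∀ {a} → ¬ p∣ a → IsSquare a → χ a ≡ + 1
  χ-square {a} p∤a sq with classify a
  ... | divisible p∣a _       = ⊥-elim (p∤a p∣a)
  ... | residue _ _ χa≡1      = χa≡1
  ... | nonresidue _ ¬sq _    = ⊥-elim (¬sq sq)

  χ-nonsquare : ∀ {a} → ¬ p∣ a → ¬ IsSquare a → χ a ≡ -[1+ 0 ]
  χ-nonsquare {a} p∤a ¬sq with classify a
  ... | divisible p∣a _       = ⊥-elim (p∤a p∣a)
  ... | residue _ sq _        = ⊥-elim (¬sq sq)
  ... | nonresidue _ _ χa≡-1  = χa≡-1

  χ-y² : ∀ {y} → ¬ p∣ y → χ (y * y) ≡ + 1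
  χ-y² {y} p∤y = χ-square (p∤* p∤y p∤y) (y , ≈-refl)

  χ-1 : χ (+ 1) ≡ + 1
  χ-1 = χ-square p∤1 (+ 1 , ≈-refl)

  χ≤1 : ∀ a → χ a ≤ + 1
  χ≤1 a with classify a
  ... | divisible _ χa≡0     = subst (_≤ + 1) (sym χa≡0) (ℤ.+≤+ ℕ.z≤n)
  ... | residue _ _ χa≡1     = subst (_≤ + 1) (sym χa≡1) ℤP.≤-refl
  ... | nonresidue _ _ χa≡-1 = subst (_≤ + 1) (sym χa≡-1) ℤ.-≤+

  -1≤χ : ∀ a → -[1+ 0 ] ≤ χ a
  -1≤χ a with classify a
  ... | divisible _ χa≡0     = subst (-[1+ 0 ] ≤_) (sym χa≡0) ℤ.-≤+
  ... | residue _ _ χa≡1     = subst (-[1+ 0 ] ≤_) (sym χa≡1) ℤ.-≤+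
  ... | nonresidue _ _ χa≡-1 = subst (-[1+ 0 ] ≤_) (sym χa≡-1) ℤP.≤-refl

  square-roots : ∀ {y y₀} → y * y ≈ y₀ * y₀ → y ≈ y₀ ⊎ y ≈ - y₀
  square-roots {y} {y₀} y²≈y₀² =
    ⊎-map p∣-diff⇒≈ (λ p∣y+y₀ → p∣-diff⇒≈ (p∣-resp-≡ (plus y y₀) p∣y+y₀))
          (euclid (p∣-resp-≡ (difference y y₀) (≈⇒p∣-diff y²≈y₀²)))
    where
    difference : ∀ y y₀ → y * y - y₀ * y₀ ≡ (y - y₀) * (y + y₀)
    difference = solve-∀
    plus : ∀ y y₀ → y + y₀ ≡ y - (- y₀)
    plus = solve-∀

  root-count : ∀ a → Σₚ (λ y → ⟦ y * y ≈ a ⟧) ≡ + 1 + χ a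
  root-count a with classify a
  ... | divisible p∣a χa≡0 =
    trans (Σₚ-cong (λ y → 𝟙-iff (y * y ≈? a) (y ≈? + 0) (λ y²≈a → [ (λ h → h) , (λ h → h) ] (euclid {y} {y} (≈-trans y²≈a p∣a)))
                                                    (λ y≈0 → ≈-trans (*-cong y≈0 y≈0) (≈-sym p∣a))))
          (trans (class-size (+ 0)) (cong (_+_ (+ 1)) (sym χa≡0)))
  ... | residue p∤a (y₀ , y₀²≈a) χa≡1 =
    trans (Σₚ-cong (λ y → 𝟙-disjoint (y * y ≈? a) (y ≈? y₀) (y ≈? - y₀) (λ y²≈a → square-roots (≈-trans y²≈a (≈-sym y₀²≈a)))
                            (λ y≈y₀ → ≈-trans (*-cong y≈y₀ y≈y₀) y₀²≈a)
                            (λ y≈-y₀ → ≈-trans (*-cong y≈-y₀ y≈-y₀) (≈-trans (≡⇒≈ (neg-square y₀)) y₀²≈a))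
                            distinct))
          (trans (Σ-+ p _ _) (trans (cong₂ _+_ (class-size y₀) (class-size (- y₀))) (cong (_+_ (+ 1)) (sym χa≡1))))
    where
    neg-square : ∀ y → (- y) * (- y) ≡ y * y
    neg-square = solve-∀
    twice : ∀ y → y - (- y) ≡ + 2 * y
    twice = solve-∀
    distinct : ∀ {y} → y ≈ y₀ → y ≈ - y₀ → ⊥
    distinct y≈y₀ y≈-y₀ = [ p∤2 , (λ p∣y₀ → p∤a (≈-trans (≈-sym y₀²≈a) (*-cong p∣y₀ p∣y₀))) ]
                            (euclid (p∣-resp-≡ (twice y₀) (≈⇒p∣-diff (≈-trans (≈-sym y≈y₀) y≈-y₀))))
  ... | nonresidue _ ¬sq χa≡-1 =
    trans (Σₚ-cong (λ y → 𝟙-no (y * y ≈? a) (λ y²≈a → ¬sq (y , y²≈a))))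
          (trans (Σ-zero p) (cong (_+_ (+ 1)) (sym χa≡-1)))

  -- Counting pairs (a, y) with y² ≈ a in two ways: Σₐ (1 + χ a) = p, so Σₐ χ a = 0.
  Σχ≡0 : Σₚ χ ≡ + 0
  Σχ≡0 = trans (isolate (Σₚ χ) (+ p)) (trans (cong (_- + p) double-count) (ℤP.+-inverseʳ (+ p)))
    where
    open ≡-Reasoning
    isolate : ∀ x c → x ≡ (c + x) - c
    isolate = solve-∀
    double-count : + p + Σₚ χ ≡ + p
    double-count = begin
      + p + Σₚ χ                                 ≡⟨ cong (_+ Σₚ χ) (sym (Σ-one p)) ⟩
      Σ< p (λ _ → + 1) + Σₚ χ                    ≡⟨ sym (Σ-+ p _ _) ⟩
      Σₚ (λ a → + 1 + χ a)                        ≡⟨ Σₚ-cong (λ a → sym (root-count a)) ⟩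
      Σ< p (λ a → Σₚ (λ y → ⟦ y * y ≈ + a ⟧))     ≡⟨ Σ-swap p p _ ⟩
      Σ< p (λ y → Σₚ (λ a → ⟦ + y * + y ≈ a ⟧))   ≡⟨ Σ-cong p (λ y _ → trans (Σₚ-cong (λ a → ⟦⟧-sym (+ y * + y) a))
                                                                              (class-size _)) ⟩
      Σ< p (λ _ → + 1)                           ≡⟨ Σ-one p ⟩
      + p                                        ∎

  IsSquare-* : ∀ {a b} → IsSquare a → IsSquare b → IsSquare (a * b)
  IsSquare-* (ya , ya²≈a) (yb , yb²≈b) = ya * yb , ≈-trans (≡⇒≈ (regroup ya yb)) (*-cong ya²≈a yb²≈b)
    where
    regroup : ∀ y z → (y * z) * (y * z) ≡ (y * y) * (z * z)
    regroup = solve-∀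

  -- A nonzero square times a nonsquare is a nonsquare: divide by the square root.
  square*nonsquare : ∀ {a b} → ¬ p∣ a → IsSquare a → ¬ IsSquare b → ¬ IsSquare (a * b)
  square*nonsquare {a} {b} p∤a (ya , ya²≈a) ¬sq (y , y²≈ab) = ¬sq (y * w , y*w²≈b)
    where
    open ≈-Reasoning
    p∤ya : ¬ p∣ ya
    p∤ya p∣ya = p∤a (≈-trans (≈-sym ya²≈a) (*-cong p∣ya p∣ya))
    w = proj₁ (inverse ya p∤ya)
    ya*w≈1 = proj₂ (inverse ya p∤ya)
    r₁ : ∀ y w → (y * w) * (y * w) ≡ (y * y) * (w * w)
    r₁ = solve-∀
    r₂ : ∀ u w b → (u * b) * (w * w) ≡ (u * w * w) * b
    r₂ = solve-∀
    r₃ : ∀ y w b → ((y * y) * w * w) * b ≡ ((y * w) * (y * w)) * b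
    r₃ = solve-∀
    y*w²≈b : (y * w) * (y * w) ≈ b
    y*w²≈b = begin
      (y * w) * (y * w)           ≡⟨ r₁ y w ⟩
      (y * y) * (w * w)           ≈⟨ *-congʳ (w * w) y²≈ab ⟩
      (a * b) * (w * w)           ≡⟨ r₂ a w b ⟩
      (a * w * w) * b             ≈⟨ *-congʳ b (*-congʳ w (*-congʳ w (≈-sym ya²≈a))) ⟩
      ((ya * ya) * w * w) * b     ≡⟨ r₃ ya w b ⟩
      ((ya * w) * (ya * w)) * b   ≈⟨ *-congʳ b (*-cong ya*w≈1 ya*w≈1) ⟩
      (+ 1 * + 1) * b             ≡⟨ ℤP.*-identityˡ b ⟩
      b                           ∎

  -- The sum of χ (n x) + χ x over x vanishes
  -- (x ↦ n x permutes the residues), and each term is ≤ 0 since n · square is a nonsquare;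
  -- hence every term vanishes.
  module NonsquareTwist (n : ℤ) (p∤n : ¬ p∣ n) (¬sq : ¬ IsSquare n) where
    twist : ℤ → ℤ
    twist x = χ (n * x) + χ x

    twist-resp : Respects≈ twist
    twist-resp x≈y = cong₂ _+_ (χ-resp (*-congˡ n x≈y)) (χ-resp x≈y)

    Σtwist≡0 : Σₚ twist ≡ + 0
    Σtwist≡0 = trans (Σ-+ p (λ x → χ (n * + x)) (λ x → χ (+ x)))
      (cong₂ _+_ (trans (Σₚ-cong (λ x → cong χ (sym (ℤP.+-identityʳ (n * x))))) (trans (reindex-unit n (+ 0) p∤n χ χ-resp) Σχ≡0))
                 Σχ≡0)

    twist≤0 : ∀ x → twist x ≤ + 0
    twist≤0 x with classify x
    ... | divisible p∣x χx≡0 = ℤP.≤-reflexive (cong₂ _+_ (χ-p∣ (p∣*ʳ n p∣x)) χx≡0)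
    ... | residue p∤x sq χx≡1 = ℤP.≤-reflexive (cong₂ _+_
          (trans (cong χ (ℤP.*-comm n x)) (χ-nonsquare (p∤* p∤x p∤n) (square*nonsquare p∤x sq ¬sq))) χx≡1)
    ... | nonresidue _ _ χx≡-1 = subst (λ v → χ (n * x) + v ≤ + 0) (sym χx≡-1) (ℤP.+-monoˡ-≤ -[1+ 0 ] (χ≤1 (n * x)))

    twist≡0 : ∀ x → twist x ≡ + 0
    twist≡0 x = trans (twist-resp (≈-mod x))
      (Σ-nonpos-zero p (λ y → twist (+ y)) (λ y _ → twist≤0 (+ y)) Σtwist≡0 (x %ℕ p) (n%ℕd<d x p))

  χ-mul : ∀ a b → χ (a * b) ≡ χ a * χ b
  χ-mul a b = by-class (classify a) (classify b)
    where
    χab≡-1*-1 : ∀ {u} → u + -[1+ 0 ] ≡ + 0 → u ≡ + 1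
    χab≡-1*-1 {u} sum≡0 = trans (shift u) (cong (_+ + 1) sum≡0)
      where
      shift : ∀ u → u ≡ (u + -[1+ 0 ]) + + 1
      shift = solve-∀
    by-class : Class a → Class b → χ (a * b) ≡ χ a * χ b
    by-class (divisible p∣a χa≡0) _ =
      trans (χ-p∣ (p∣*ˡ b p∣a)) (sym (trans (cong (_* χ b) χa≡0) (ℤP.*-zeroˡ (χ b))))
    by-class (residue _ _ _) (divisible p∣b χb≡0) =
      trans (χ-p∣ (p∣*ʳ a p∣b)) (sym (trans (cong (χ a *_) χb≡0) (ℤP.*-zeroʳ (χ a))))
    by-class (nonresidue _ _ _) (divisible p∣b χb≡0) =
      trans (χ-p∣ (p∣*ʳ a p∣b)) (sym (trans (cong (χ a *_) χb≡0) (ℤP.*-zeroʳ (χ a))))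
    by-class (residue p∤a sqa χa) (residue p∤b sqb χb) =
      trans (χ-square (p∤* p∤a p∤b) (IsSquare-* sqa sqb)) (sym (cong₂ _*_ χa χb))
    by-class (residue p∤a sqa χa) (nonresidue p∤b ¬sqb χb) =
      trans (χ-nonsquare (p∤* p∤a p∤b) (square*nonsquare p∤a sqa ¬sqb)) (sym (cong₂ _*_ χa χb))
    by-class (nonresidue p∤a ¬sqa χa) (residue p∤b sqb χb) =
      trans (cong χ (ℤP.*-comm a b))
            (trans (χ-nonsquare (p∤* p∤b p∤a) (square*nonsquare p∤b sqb ¬sqa)) (sym (cong₂ _*_ χa χb)))
    by-class (nonresidue p∤a ¬sqa χa) (nonresidue _ _ χb) =
      trans (χab≡-1*-1 (trans (cong (_+_ (χ (a * b))) (sym χb)) (NonsquareTwist.twist≡0 a p∤a ¬sqa b)))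
            (sym (cong₂ _*_ χa χb))

  χ²≡1 : ∀ {y} → ¬ p∣ y → χ y * χ y ≡ + 1
  χ²≡1 {y} p∤y = trans (sym (χ-mul y y)) (χ-y² p∤y)

  χ-inverse : ∀ {b b′} → b * b′ ≈ + 1 → χ b′ ≡ χ b
  χ-inverse {b} {b′} bb′≈1 with classify b
  ... | divisible p∣b _ = ⊥-elim (p∤1 (≈-trans (≈-sym bb′≈1) (p∣*ˡ b′ p∣b)))
  ... | residue _ _ χb≡1 =
    trans (sym (ℤP.*-identityˡ (χ b′))) (trans (cong (_* χ b′) (sym χb≡1)) (trans product≡1 (sym χb≡1)))
    where
    product≡1 : χ b * χ b′ ≡ + 1
    product≡1 = trans (sym (χ-mul b b′)) (trans (χ-resp bb′≈1) χ-1)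
  ... | nonresidue _ _ χb≡-1 =
    trans (negate (χ b′)) (trans (cong (λ v → - (v * χ b′)) (sym χb≡-1)) (trans (cong -_ product≡1) (sym χb≡-1)))
    where
    product≡1 : χ b * χ b′ ≡ + 1
    product≡1 = trans (sym (χ-mul b b′)) (trans (χ-resp bb′≈1) χ-1)
    negate : ∀ x → x ≡ - (-[1+ 0 ] * x)
    negate = solve-∀

  nonzero : ℤ → ℤ
  nonzero a = + 1 - ⟦ a ≈ + 0 ⟧

  Σnonzero : Σₚ nonzero ≡ + p - + 1
  Σnonzero = trans (Σ-+ p (λ _ → + 1) (λ x → - ⟦ + x ≈ + 0 ⟧))
                   (cong₂ _+_ (Σ-one p) (trans (Σ-neg p _) (cong -_ (class-size (+ 0)))))

  χ-s² : ∀ s → χ (s * s) ≡ nonzero s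
  χ-s² s with p∣? s
  ... | yes p∣s = χ-p∣ (p∣*ˡ s p∣s)
  ... | no p∤s  = χ-y² p∤s

  linear-count : ∀ α d → ¬ p∣ d → Σₚ (λ β → ⟦ α * β ≈ d ⟧) ≡ nonzero α
  linear-count α d p∤d with p∣? α
  ... | yes p∣α = trans (Σₚ-cong (λ β → 𝟙-no (α * β ≈? d) (λ αβ≈d → p∤d (≈-trans (≈-sym αβ≈d) (p∣*ˡ β p∣α)))))
                        (Σ-zero p)
  ... | no p∤α  = trans (Σₚ-cong (λ β → 𝟙-iff (α * β ≈? d) (β ≈? α′ * (d - + 0))
                          (λ αβ≈d → affine-solve {α} {α′} inv {+ 0} {d} {β} (≈-trans (≈-sym αβ≈d) (≡⇒≈ (sym (ℤP.+-identityʳ (α * β))))))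
                          (λ β≈ → ≈-sym (≈-trans (affine-unsolve {α} {α′} inv {+ 0} {d} {β} β≈) (≡⇒≈ (ℤP.+-identityʳ (α * β)))))))
                        (class-size _)
    where
    α′ = proj₁ (inverse α p∤α)
    inv = proj₂ (inverse α p∤α)

  χ-4* : ∀ x → χ (+ 4 * x) ≡ χ x
  χ-4* x = trans (χ-mul (+ 4) x) (trans (cong (_* χ x) (χ-y² {+ 2} p∤2)) (ℤP.*-identityˡ (χ x)))

  -- Writing a square root w of u² - d as w = u - α, the roots correspond to the α with
  -- α (2 u - α) ≈ d.
  root-count-shifted : ∀ u d → Σₚ (λ w → ⟦ w * w ≈ u * u - d ⟧) ≡ Σₚ (λ α → ⟦ α * (+ 2 * u - α) ≈ d ⟧)
  root-count-shifted u d =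
    trans (sym (reindex-unit (- + 1) u (λ p∣-1 → p∤1 (neg-cong p∣-1))
                             (λ w → ⟦ w * w ≈ u * u - d ⟧) (λ w≈w′ → ⟦⟧-cong (*-cong w≈w′ w≈w′) ≈-refl)))
          (Σₚ-cong (λ α → 𝟙-iff ((- + 1 * α + u) * (- + 1 * α + u) ≈? u * u - d) (α * (+ 2 * u - α) ≈? d)
            (λ root → ≈-trans (≈-trans (≡⇒≈ (sym (difference u (α * (+ 2 * u - α)))))
                                       (+-congˡ (u * u) (neg-cong (≈-trans (≡⇒≈ (sym (shifted-root α u))) root))))
                              (≡⇒≈ (difference u d)))
            (λ α[2u-α]≈d → ≈-trans (≡⇒≈ (shifted-root α u)) (+-congˡ (u * u) (neg-cong α[2u-α]≈d)))))
    where
    shifted-root : ∀ α u → (- + 1 * α + u) * (- + 1 * α + u) ≡ u * u - α * (+ 2 * u - α)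
    shifted-root = solve-∀
    difference : ∀ u d → u * u - (u * u - d) ≡ d
    difference = solve-∀

  -- Summing over u first: for fixed α ≢ 0, u ↦ α (2 u - α) is a bijection, so each α ≢ 0
  -- contributes exactly one u.
  shifted-total : ∀ d → ¬ p∣ d → Σₚ (λ u → Σₚ (λ α → ⟦ α * (+ 2 * u - α) ≈ d ⟧)) ≡ + p - + 1
  shifted-total d p∤d = begin
    Σ< p (λ u → Σₚ (λ α → ⟦ α * (+ 2 * + u - α) ≈ d ⟧))
      ≡⟨ Σ-swap p p _ ⟩
    Σ< p (λ α → Σₚ (λ u → ⟦ + α * (+ 2 * u - + α) ≈ d ⟧))
      ≡⟨ Σ-cong p (λ α _ → trans (reindex-unit (+ 2) (- + α) p∤2 (λ β → ⟦ + α * β ≈ d ⟧)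
                                                (λ β≈β′ → ⟦⟧-cong (*-congˡ (+ α) β≈β′) ≈-refl))
                                  (linear-count (+ α) d p∤d)) ⟩
    Σₚ nonzero
      ≡⟨ Σnonzero ⟩
    + p - + 1 ∎
    where open ≡-Reasoning

  -- Jacobsthal: Σₛ χ (s (s + e)) = -1 for e ≢ 0.  Completing the square,
  -- 4 s (s + e) = u² - e² with u = 2 s + e, and χ (u² - e²) is one less than the number of
  -- square roots of u² - e², whose total over u is p - 1.
  jacobsthal : ∀ e → ¬ p∣ e → Σₚ (λ s → χ (s * (s + e))) ≡ -[1+ 0 ]
  jacobsthal e p∤e = begin
      Σₚ (λ s → χ (s * (s + e)))
        ≡⟨ Σₚ-cong (λ s → trans (sym (χ-4* (s * (s + e)))) (cong χ (complete-square s e))) ⟩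
      Σₚ (λ s → G (+ 2 * s + e))
        ≡⟨ reindex-unit (+ 2) e p∤2 G G-resp ⟩
      Σₚ G
        ≡⟨ Σₚ-cong (λ u → trans (plus-minus (G u)) (cong (_- + 1) (sym (root-count (u * u - d))))) ⟩
      Σₚ (λ u → N u - + 1)
        ≡⟨ Σ-+ p (λ u → N (+ u)) (λ _ → - + 1) ⟩
      Σₚ N + Σ< p (λ _ → - + 1)
        ≡⟨ cong₂ _+_ ΣN (trans (Σ-neg p (λ _ → + 1)) (cong -_ (Σ-one p))) ⟩
      (+ p - + 1) - + p
        ≡⟨ cancel (+ p) ⟩
      -[1+ 0 ] ∎
    where
    open ≡-Reasoning
    d = e * e
    complete-square : ∀ s e → + 4 * (s * (s + e)) ≡ (+ 2 * s + e) * (+ 2 * s + e) - e * e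
    complete-square = solve-∀
    plus-minus : ∀ x → x ≡ (+ 1 + x) - + 1
    plus-minus = solve-∀
    cancel : ∀ q → (q - + 1) - q ≡ -[1+ 0 ]
    cancel = solve-∀
    G : ℤ → ℤ
    G u = χ (u * u - d)
    G-resp : Respects≈ G
    G-resp u≈v = χ-resp (+-congʳ (- d) (*-cong u≈v u≈v))
    N : ℤ → ℤ
    N u = Σₚ (λ w → ⟦ w * w ≈ u * u - d ⟧)
    ΣN : Σₚ N ≡ + p - + 1
    ΣN = trans (Σ-cong p (λ u _ → root-count-shifted (+ u) d)) (shifted-total d (p∤* p∤e p∤e))

  jacobsthal-degenerate : ∀ e → p∣ e → Σₚ (λ s → χ (s * (s + e))) ≡ + p - + 1
  jacobsthal-degenerate e p∣e =
    trans (Σₚ-cong (λ s → trans (χ-resp (≈-trans (*-congˡ s (+-congˡ s p∣e)) (≡⇒≈ (cong (s *_) (ℤP.+-identityʳ s)))))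
                                (χ-s² s)))
          Σnonzero

  pairSum : ℤ → ℤ → ℤ → ℤ → ℤ
  pairSum A B C D = Σₚ (λ t → χ ((A + B * t) * (C + D * t)))

  pairSum-comm : ∀ A B C D → pairSum A B C D ≡ pairSum C D A B
  pairSum-comm A B C D = Σₚ-cong (λ t → cong χ (ℤP.*-comm (A + B * t) (C + D * t)))

  private
    constant-line : ∀ A B t → p∣ B → A + B * t ≈ A
    constant-line A B t p∣B = ≈-trans (+-congˡ A (p∣*ˡ t p∣B)) (≡⇒≈ (ℤP.+-identityʳ A))

  -- One constant factor: χ A times a complete sum of χ, which vanishes.
  pairSum-one-constant : ∀ A B C D → p∣ B → ¬ p∣ D → pairSum A B C D ≡ + 0
  pairSum-one-constant A B C D p∣B p∤D = begin
      pairSum A B C D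
        ≡⟨ Σₚ-cong (λ t → trans (χ-resp (*-congʳ (C + D * t) (constant-line A B t p∣B))) (χ-mul A (C + D * t))) ⟩
      Σₚ (λ t → χ A * χ (C + D * t))
        ≡⟨ Σ-*ˡ p (χ A) (λ t → χ (C + D * + t)) ⟩
      χ A * Σₚ (λ t → χ (C + D * t))
        ≡⟨ cong (χ A *_) (trans (Σₚ-cong (λ t → cong χ (ℤP.+-comm C (D * t))))
                                 (trans (reindex-unit D C p∤D χ χ-resp) Σχ≡0)) ⟩
      χ A * + 0
        ≡⟨ ℤP.*-zeroʳ (χ A) ⟩
      + 0 ∎
    where open ≡-Reasoning

  pairSum-both-constant : ∀ A B C D → p∣ B → p∣ D → pairSum A B C D ≡ + p * χ (A * C)
  pairSum-both-constant A B C D p∣B p∣D =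
    trans (Σₚ-cong (λ t → χ-resp (*-cong (constant-line A B t p∣B) (constant-line C D t p∣D))))
          (Σ-const p (χ (A * C)))

  -- Two genuine lines: substituting t = B′ (s - A) with B B′ ≈ 1 turns the summand into
  -- χ (B D) χ (s (s + e)) with e = C B D′ - A, where D e ≈ C B - D A.
  module TwoLines (A B C D : ℤ) (p∤B : ¬ p∣ B) (p∤D : ¬ p∣ D) where
    B′ = proj₁ (inverse B p∤B)
    BB′≈1 = proj₂ (inverse B p∤B)
    D′ = proj₁ (inverse D p∤D)
    DD′≈1 = proj₂ (inverse D p∤D)

    p∤B′ : ¬ p∣ B′
    p∤B′ p∣B′ = p∤1 (≈-trans (≈-sym BB′≈1) (p∣*ʳ B p∣B′))

    e : ℤ
    e = C * B * D′ - A

    t[s] : ℤ → ℤ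
    t[s] s = B′ * s + - (B′ * A)

    private
      r₁ : ∀ A B B′ s → A + B * (B′ * s + - (B′ * A)) ≡ A + (B * B′) * s - (B * B′) * A
      r₁ = solve-∀
      r₂ : ∀ A s → A + + 1 * s - + 1 * A ≡ s
      r₂ = solve-∀
      r₃ : ∀ C D B′ A s → C + D * (B′ * s + - (B′ * A)) ≡ (D * B′) * s + C - (D * B′) * A
      r₃ = solve-∀
      r₄ : ∀ C D B′ A s B D′ → (D * B′) * (s + (C * B * D′ - A)) ≡ (D * B′) * s + C * (B * B′) * (D * D′) - (D * B′) * A
      r₄ = solve-∀
      r₅ : ∀ C → C * + 1 * + 1 ≡ C
      r₅ = solve-∀
      r₆ : ∀ X s e → s * (X * (s + e)) ≡ X * (s * (s + e))
      r₆ = solve-∀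
      r₇ : ∀ D C B D′ A → D * (C * B * D′ - A) ≡ C * B * (D * D′) - D * A
      r₇ = solve-∀
      r₈ : ∀ C B → C * B * + 1 ≡ C * B
      r₈ = solve-∀

    first-line : ∀ s → A + B * t[s] s ≈ s
    first-line s = ≈-trans (≡⇒≈ (r₁ A B B′ s))
                           (≈-trans (+-cong (+-congˡ A (*-congʳ s BB′≈1)) (neg-cong (*-congʳ A BB′≈1))) (≡⇒≈ (r₂ A s)))

    second-line : ∀ s → C + D * t[s] s ≈ (D * B′) * (s + e)
    second-line s = ≈-trans (≡⇒≈ (r₃ C D B′ A s))
      (≈-sym (≈-trans (≡⇒≈ (r₄ C D B′ A s B D′))
                      (+-congʳ (- ((D * B′) * A)) (+-congˡ ((D * B′) * s)
                                                           (≈-trans (*-cong (*-congˡ C BB′≈1) DD′≈1) (≡⇒≈ (r₅ C)))))))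

    pairSum≡jacobsthal : pairSum A B C D ≡ χ (B * D) * Σₚ (λ s → χ (s * (s + e)))
    pairSum≡jacobsthal = begin
      pairSum A B C D
        ≡⟨ sym (reindex-unit B′ (- (B′ * A)) p∤B′ (λ t → χ ((A + B * t) * (C + D * t)))
                             (λ t≈t′ → χ-resp (*-cong (+-congˡ A (*-congˡ B t≈t′)) (+-congˡ C (*-congˡ D t≈t′))))) ⟩
      Σₚ (λ s → χ ((A + B * t[s] s) * (C + D * t[s] s)))
        ≡⟨ Σₚ-cong (λ s → trans (χ-resp (≈-trans (*-cong (first-line s) (second-line s)) (≡⇒≈ (r₆ (D * B′) s e))))
                                (χ-mul (D * B′) (s * (s + e)))) ⟩
      Σₚ (λ s → χ (D * B′) * χ (s * (s + e)))
        ≡⟨ Σ-*ˡ p (χ (D * B′)) (λ s → χ (+ s * (+ s + e))) ⟩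
      χ (D * B′) * Σₚ (λ s → χ (s * (s + e)))
        ≡⟨ cong (_* Σₚ (λ s → χ (s * (s + e)))) χDB′≡χBD ⟩
      χ (B * D) * Σₚ (λ s → χ (s * (s + e))) ∎
      where
      open ≡-Reasoning
      χDB′≡χBD : χ (D * B′) ≡ χ (B * D)
      χDB′≡χBD = trans (χ-mul D B′) (trans (cong (χ D *_) (χ-inverse BB′≈1))
                                             (trans (ℤP.*-comm (χ D) (χ B)) (sym (χ-mul B D))))

    De≈ : D * e ≈ C * B - D * A
    De≈ = ≈-trans (≡⇒≈ (r₇ D C B D′ A)) (+-congʳ (- (D * A)) (≈-trans (*-congˡ (C * B) DD′≈1) (≡⇒≈ (r₈ C B))))

    p∣e⇒ : p∣ e → p∣ (C * B - D * A)
    p∣e⇒ p∣e = ≈-trans (≈-sym De≈) (p∣*ʳ D p∣e)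

    ⇒p∣e : p∣ (C * B - D * A) → p∣ e
    ⇒p∣e p∣det = [ (λ p∣D → ⊥-elim (p∤D p∣D)) , (λ p∣e → p∣e) ] (euclid {D} {e} (≈-trans De≈ p∣det))

  pairSum-generic : ∀ A B C D → ¬ p∣ B → ¬ p∣ D → ¬ p∣ (C * B - D * A) → pairSum A B C D ≡ - χ (B * D)
  pairSum-generic A B C D p∤B p∤D p∤det =
    trans (TwoLines.pairSum≡jacobsthal A B C D p∤B p∤D)
          (trans (cong (χ (B * D) *_) (jacobsthal _ (λ p∣e → p∤det (TwoLines.p∣e⇒ A B C D p∤B p∤D p∣e))))
                 (times-1 (χ (B * D))))
    where
    times-1 : ∀ x → x * -[1+ 0 ] ≡ - x
    times-1 = solve-∀

  pairSum-proportional : ∀ A B C D → ¬ p∣ B → ¬ p∣ D → p∣ (C * B - D * A) → pairSum A B C D ≡ χ (B * D) * (+ p - + 1)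
  pairSum-proportional A B C D p∤B p∤D p∣det =
    trans (TwoLines.pairSum≡jacobsthal A B C D p∤B p∤D)
          (cong (χ (B * D) *_) (jacobsthal-degenerate _ (TwoLines.⇒p∣e A B C D p∤B p∤D p∣det)))

  g : ℤ → ℤ
  g x = x * x * x - + 3 * x + + 1

  h : ℤ → ℤ
  h x = x * x - x

  cubic≡ : ∀ t x → cubic t x ≡ g x + h x * t
  cubic≡ = regroup
    where
    regroup : ∀ t x → x * x * x + t * x * x - (t + + 3) * x + + 1 ≡ (x * x * x - + 3 * x + + 1) + (x * x - x) * t
    regroup = solve-∀

  A : ℤ → ℤ
  A t = Σₚ (λ x → χ (g x + h x * t))

  a≡A : ∀ t → a (+ t) p ≡ A (+ t)
  a≡A t = trans (Σ-foldr p (λ x → legendre (cubic (+ t) (+ x)) p) (λ x → x))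
                (Σ-cong p (λ x _ → trans (legendre≡χ (cubic (+ t) (+ x))) (cong χ (cubic≡ (+ t) (+ x)))))

  secondMoment : ℤ
  secondMoment = Σₚ (λ t → A t * A t)

  -- the numerator of - Q(p, p) in Defs
  sum-of-squares≡ : foldr _+_ (+ 0) (map (λ t → a (+ t) p * a (+ t) p) (upTo p)) ≡ secondMoment
  sum-of-squares≡ = trans (Σ-foldr p (λ t → a (+ t) p * a (+ t) p) (λ x → x))
                          (Σ-cong p (λ t _ → cong₂ _*_ (a≡A t) (a≡A t)))

  secondMoment-expand : secondMoment ≡ Σₚ (λ x → Σₚ (λ y → pairSum (g x) (h x) (g y) (h y)))
  secondMoment-expand = begin
      Σₚ (λ t → A t * A t)
        ≡⟨ Σ-cong p (λ t _ → trans (sym (Σ-*ʳ p (A (+ t)) (λ x → χ (g (+ x) + h (+ x) * + t))))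
              (Σ-cong p (λ x _ → trans (ℤP.*-comm _ (A (+ t))) (sym (Σ-*ʳ p _ (λ y → χ (g (+ y) + h (+ y) * + t))))))) ⟩
      Σ< p (λ t → Σ< p (λ x → Σ< p (λ y → χ (g (+ y) + h (+ y) * + t) * χ (g (+ x) + h (+ x) * + t))))
        ≡⟨ Σ-swap p p _ ⟩
      Σ< p (λ x → Σ< p (λ t → Σ< p (λ y → χ (g (+ y) + h (+ y) * + t) * χ (g (+ x) + h (+ x) * + t))))
        ≡⟨ Σ-cong p (λ x _ → Σ-swap p p _) ⟩
      Σ< p (λ x → Σ< p (λ y → Σ< p (λ t → χ (g (+ y) + h (+ y) * + t) * χ (g (+ x) + h (+ x) * + t))))
        ≡⟨ Σ-cong p (λ x _ → Σ-cong p (λ y _ → Σ-cong p (λ t _ →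
              trans (ℤP.*-comm (χ (g (+ y) + h (+ y) * + t)) _) (sym (χ-mul _ _))))) ⟩
      Σₚ (λ x → Σₚ (λ y → pairSum (g x) (h x) (g y) (h y))) ∎
    where open ≡-Reasoning

  -- The two lines t ↦ g x + h x t and t ↦ g y + h y t are proportional iff this vanishes.
  resultant : ℤ → ℤ → ℤ
  resultant x y = g y * h x - h y * g x

  -- The coefficient of p in the pair sum, by the case distinction of the previous section.
  mainTermBy : ∀ {P₁ P₂ P₃ : Set} → Dec P₁ → Dec P₂ → Dec P₃ → ℤ → ℤ → ℤ
  mainTermBy (yes _) (yes _) _       _ bothConstant = bothConstant
  mainTermBy (yes _) (no _)  _       _ _            = + 0
  mainTermBy (no _)  (yes _) _       _ _            = + 0
  mainTermBy (no _)  (no _)  (yes _) proportional _ = proportional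
  mainTermBy (no _)  (no _)  (no _)  _ _            = + 0

  mainTerm : ℤ → ℤ → ℤ
  mainTerm x y = mainTermBy (p∣? (h x)) (p∣? (h y)) (p∣? (resultant x y)) (χ (h x * h y)) (χ (g x * g y))

  pairSum-decompose : ∀ x y → pairSum (g x) (h x) (g y) (h y) ≡ - (χ (h x) * χ (h y)) + + p * mainTerm x y
  pairSum-decompose x y = by-cases (p∣? (h x)) (p∣? (h y)) (p∣? (resultant x y))
    where
    r₁ : ∀ P v → P * v ≡ - (+ 0 * + 0) + P * v
    r₁ = solve-∀
    r₂ : ∀ P c → + 0 ≡ - (+ 0 * c) + P * + 0
    r₂ = solve-∀
    r₃ : ∀ P c → + 0 ≡ - (c * + 0) + P * + 0
    r₃ = solve-∀
    r₄ : ∀ P u → u * (P - + 1) ≡ - u + P * u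
    r₄ = solve-∀
    r₅ : ∀ P u → - u ≡ - u + P * + 0
    r₅ = solve-∀
    by-cases : (d₁ : Dec (p∣ h x)) (d₂ : Dec (p∣ h y)) (d₃ : Dec (p∣ resultant x y)) →
               pairSum (g x) (h x) (g y) (h y) ≡ - (χ (h x) * χ (h y)) + + p * mainTermBy d₁ d₂ d₃ (χ (h x * h y)) (χ (g x * g y))
    by-cases (yes p∣hx) (yes p∣hy) _ =
      trans (pairSum-both-constant (g x) (h x) (g y) (h y) p∣hx p∣hy)
            (trans (r₁ (+ p) (χ (g x * g y))) (cong (λ w → - w + + p * χ (g x * g y)) (sym (cong₂ _*_ (χ-p∣ p∣hx) (χ-p∣ p∣hy)))))
    by-cases (yes p∣hx) (no p∤hy) _ =
      trans (pairSum-one-constant (g x) (h x) (g y) (h y) p∣hx p∤hy)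
            (trans (r₂ (+ p) (χ (h y))) (cong (λ w → - (w * χ (h y)) + + p * + 0) (sym (χ-p∣ p∣hx))))
    by-cases (no p∤hx) (yes p∣hy) _ =
      trans (pairSum-comm (g x) (h x) (g y) (h y))
            (trans (pairSum-one-constant (g y) (h y) (g x) (h x) p∣hy p∤hx)
                   (trans (r₃ (+ p) (χ (h x))) (cong (λ w → - (χ (h x) * w) + + p * + 0) (sym (χ-p∣ p∣hy)))))
    by-cases (no p∤hx) (no p∤hy) (yes p∣res) =
      trans (pairSum-proportional (g x) (h x) (g y) (h y) p∤hx p∤hy p∣res)
            (trans (r₄ (+ p) (χ (h x * h y))) (cong (λ w → - w + + p * χ (h x * h y)) (χ-mul (h x) (h y))))
    by-cases (no p∤hx) (no p∤hy) (no p∤res) =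
      trans (pairSum-generic (g x) (h x) (g y) (h y) p∤hx p∤hy p∤res)
            (trans (r₅ (+ p) (χ (h x * h y))) (cong (λ w → - w + + p * + 0) (χ-mul (h x) (h y))))

  mainTotal : ℤ
  mainTotal = Σₚ (λ x → Σₚ (λ y → mainTerm x y))

  Σχh : Σₚ (λ x → χ (h x)) ≡ -[1+ 0 ]
  Σχh = trans (Σₚ-cong (λ x → cong χ (factor x))) (jacobsthal -[1+ 0 ] p∤-1)
    where
    factor : ∀ x → x * x - x ≡ x * (x + -[1+ 0 ])
    factor = solve-∀

  secondMoment≡ : secondMoment ≡ -[1+ 0 ] + + p * mainTotal
  secondMoment≡ = begin
    secondMoment
      ≡⟨ secondMoment-expand ⟩
    Σₚ (λ x → Σₚ (λ y → pairSum (g x) (h x) (g y) (h y)))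
      ≡⟨ Σ-cong p (λ x _ → Σ-cong p (λ y _ → pairSum-decompose (+ x) (+ y))) ⟩
    Σₚ (λ x → Σₚ (λ y → - (χ (h x) * χ (h y)) + + p * mainTerm x y))
      ≡⟨ Σ-cong p (λ x _ → Σ-+ p (λ y → - (χ (h (+ x)) * χ (h (+ y)))) (λ y → + p * mainTerm (+ x) (+ y))) ⟩
    Σₚ (λ x → Σₚ (λ y → - (χ (h x) * χ (h y))) + Σₚ (λ y → + p * mainTerm x y))
      ≡⟨ Σ-+ p _ _ ⟩
    Σₚ (λ x → Σₚ (λ y → - (χ (h x) * χ (h y)))) + Σₚ (λ x → Σₚ (λ y → + p * mainTerm x y))
      ≡⟨ cong₂ _+_ square-term main-term ⟩
    -[1+ 0 ] + + p * mainTotal ∎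
    where
    open ≡-Reasoning
    square-term : Σₚ (λ x → Σₚ (λ y → - (χ (h x) * χ (h y)))) ≡ -[1+ 0 ]
    square-term =
      trans (Σ-cong p (λ x _ → trans (Σ-neg p _) (cong -_ (Σ-*ˡ p (χ (h (+ x))) (λ y → χ (h (+ y)))))))
            (trans (Σ-neg p _) (cong -_ (trans (Σ-cong p (λ x _ → cong (χ (h (+ x)) *_) Σχh))
                                               (trans (Σ-*ʳ p -[1+ 0 ] _) (cong (_* -[1+ 0 ]) Σχh)))))
    main-term : Σₚ (λ x → Σₚ (λ y → + p * mainTerm x y)) ≡ + p * mainTotal
    main-term = trans (Σ-cong p (λ x _ → Σ-*ˡ p (+ p) (λ y → mainTerm (+ x) (+ y)))) (Σ-*ˡ p (+ p) _)

  -- For h x ≢ 0 the line through x is proportional exactly to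
  -- the lines through x, σ = 1/(1 - x) and τ = (x - 1)/x (the orbit of x under the order-3 map
  -- y ↦ 1/(1 - y)); these three points coincide iff x² - x + 1 ≡ 0.

  fixedPoly : ℤ → ℤ
  fixedPoly x = x * x - x + + 1

  Proportional : ℤ → ℤ → Set
  Proportional x y = ¬ p∣ (h y) × p∣ (resultant x y)

  proportional? : ∀ x y → Dec (Proportional x y)
  proportional? x y = ¬? (p∣? (h y)) ×-dec p∣? (resultant x y)

  mainTermBy-regular : ∀ {P₁ P₂ P₃ : Set} (d₁ : Dec P₁) → ¬ P₁ → (d₂ : Dec P₂) (d₃ : Dec P₃) (u v : ℤ) →
                       mainTermBy d₁ d₂ d₃ u v ≡ u * 𝟙 (¬? d₂ ×-dec d₃)
  mainTermBy-regular (yes q₁) ¬q₁ _       _       u v = ⊥-elim (¬q₁ q₁)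
  mainTermBy-regular (no _)   _   (yes _) _       u v = sym (ℤP.*-zeroʳ u)
  mainTermBy-regular (no _)   _   (no _)  (yes _) u v = sym (ℤP.*-identityʳ u)
  mainTermBy-regular (no _)   _   (no _)  (no _)  u v = sym (ℤP.*-zeroʳ u)

  mainTermBy-degenerate : ∀ {P₁ P₂ P₃ : Set} (d₁ : Dec P₁) → P₁ → (d₂ : Dec P₂) (d₃ : Dec P₃) (u v : ℤ) →
                          mainTermBy d₁ d₂ d₃ u v ≡ v * 𝟙 d₂
  mainTermBy-degenerate (no ¬q₁) q₁ _       _ u v = ⊥-elim (¬q₁ q₁)
  mainTermBy-degenerate (yes _)  _  (yes _) _ u v = sym (ℤP.*-identityʳ v)
  mainTermBy-degenerate (yes _)  _  (no _)  _ u v = sym (ℤP.*-zeroʳ v)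

  private
    h-factor : ∀ x → h x ≡ x * (x - + 1)
    h-factor = factor
      where
      factor : ∀ x → x * x - x ≡ x * (x - + 1)
      factor = solve-∀

  p∣h⇒ : ∀ {x} → p∣ (h x) → p∣ x ⊎ x ≈ + 1
  p∣h⇒ {x} p∣hx = ⊎-map (λ q → q) p∣-diff⇒≈ (euclid (p∣-resp-≡ (h-factor x) p∣hx))

  ⇒p∣h : ∀ {x} → p∣ x ⊎ x ≈ + 1 → p∣ (h x)
  ⇒p∣h {x} (inj₁ p∣x) = p∣-resp-≡ (sym (h-factor x)) (p∣*ˡ (x - + 1) p∣x)
  ⇒p∣h {x} (inj₂ x≈1) = p∣-resp-≡ (sym (h-factor x)) (p∣*ʳ x (≈⇒p∣-diff x≈1))

  h-resp : ∀ {a b} → a ≈ b → h a ≈ h b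
  h-resp a≈b = +-cong (*-cong a≈b a≈b) (neg-cong a≈b)

  private
    resultant-factor : ∀ x y → (y * y * y - + 3 * y + + 1) * (x * x - x) - (y * y - y) * (x * x * x - + 3 * x + + 1)
                               ≡ ((x - y) * ((+ 1 - x) * y - + 1)) * (x * y - (x - + 1))
    resultant-factor = solve-∀
    fixed₁ : ∀ x → x * x - x + + 1 ≡ + 1 - (+ 1 - x) * x
    fixed₁ = solve-∀
    fixed₂ : ∀ x → x * x - x + + 1 ≡ x * x - (x - + 1)
    fixed₂ = solve-∀
    fixed₃ : ∀ x → x * x - x + + 1 ≡ x - (+ 1 - x) * (x - + 1)
    fixed₃ = solve-∀

  module RegularRow (x : ℤ) (p∤hx : ¬ p∣ (h x)) where
    p∤x : ¬ p∣ x
    p∤x p∣x = p∤hx (⇒p∣h (inj₁ p∣x))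

    x≉1 : ¬ x ≈ + 1
    x≉1 x≈1 = p∤hx (⇒p∣h (inj₂ x≈1))

    p∤x-1 : ¬ p∣ (x - + 1)
    p∤x-1 p∣x-1 = x≉1 (p∣-diff⇒≈ p∣x-1)

    ω : ℤ
    ω = + 1 - x

    p∤ω : ¬ p∣ ω
    p∤ω p∣ω = x≉1 (≈-sym (p∣-diff⇒≈ p∣ω))

    σ : ℤ
    σ = proj₁ (inverse ω p∤ω)

    ωσ≈1 : ω * σ ≈ + 1
    ωσ≈1 = proj₂ (inverse ω p∤ω)

    x′ : ℤ
    x′ = proj₁ (inverse x p∤x)

    xx′≈1 : x * x′ ≈ + 1
    xx′≈1 = proj₂ (inverse x p∤x)

    τ : ℤ
    τ = (x - + 1) * x′

    xτ≈x-1 : x * τ ≈ x - + 1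
    xτ≈x-1 = ≈-trans (≡⇒≈ (reassoc x x′)) (≈-trans (*-congˡ (x - + 1) xx′≈1) (≡⇒≈ (ℤP.*-identityʳ (x - + 1))))
      where
      reassoc : ∀ x x′ → x * ((x - + 1) * x′) ≡ (x - + 1) * (x * x′)
      reassoc = solve-∀

    σ-factor τ-factor : ℤ → ℤ
    σ-factor y = ω * y - + 1
    τ-factor y = x * y - (x - + 1)

    σ-factor⇒ : ∀ {y} → p∣ (σ-factor y) → y ≈ σ
    σ-factor⇒ {y} p∣ = cancel-≈ p∤ω (≈-trans (p∣-diff⇒≈ {ω * y} {+ 1} p∣) (≈-sym ωσ≈1))

    ⇒σ-factor : ∀ {y} → y ≈ σ → p∣ (σ-factor y)
    ⇒σ-factor y≈σ = ≈⇒p∣-diff (≈-trans (*-congˡ ω y≈σ) ωσ≈1)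

    τ-factor⇒ : ∀ {y} → p∣ (τ-factor y) → y ≈ τ
    τ-factor⇒ {y} p∣ = cancel-≈ p∤x (≈-trans (p∣-diff⇒≈ {x * y} {x - + 1} p∣) (≈-sym xτ≈x-1))

    ⇒τ-factor : ∀ {y} → y ≈ τ → p∣ (τ-factor y)
    ⇒τ-factor y≈τ = ≈⇒p∣-diff (≈-trans (*-congˡ x y≈τ) xτ≈x-1)

    proportional⇒ : ∀ {y} → Proportional x y → y ≈ x ⊎ (y ≈ σ ⊎ y ≈ τ)
    proportional⇒ {y} (_ , p∣res) =
      [ (λ p∣xy → [ (λ p∣x-y → inj₁ (≈-sym (p∣-diff⇒≈ {x} {y} p∣x-y))) , (λ p∣σ → inj₂ (inj₁ (σ-factor⇒ p∣σ))) ] (euclid {x - y} {σ-factor y} p∣xy)) ,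
        (λ p∣τ → inj₂ (inj₂ (τ-factor⇒ p∣τ))) ]
      (euclid {(x - y) * σ-factor y} {τ-factor y} (p∣-resp-≡ (resultant-factor x y) p∣res))

    p∤hσ : ∀ {y} → y ≈ σ → ¬ p∣ (h y)
    p∤hσ {y} y≈σ p∣hy = [ (λ p∣y → p∤1 (≈-trans (≈-sym ωy≈1) (p∣*ʳ ω p∣y))) ,
                          (λ y≈1 → p∤x (≈-trans (≡⇒≈ (sym (ℤP.neg-involutive x)))
                                                (neg-cong (p∣-resp-≡ (ω-1 x) (≈⇒p∣-diff (ω≈1 y≈1)))))) ] (p∣h⇒ p∣hy)
      where
      ωy≈1 : ω * y ≈ + 1
      ωy≈1 = ≈-trans (*-congˡ ω y≈σ) ωσ≈1
      ω≈1 : y ≈ + 1 → ω ≈ + 1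
      ω≈1 y≈1 = ≈-trans (≡⇒≈ (sym (ℤP.*-identityʳ ω))) (≈-trans (*-congˡ ω (≈-sym y≈1)) ωy≈1)
      ω-1 : ∀ x → (+ 1 - x) - + 1 ≡ - x
      ω-1 = solve-∀

    p∤hτ : ∀ {y} → y ≈ τ → ¬ p∣ (h y)
    p∤hτ {y} y≈τ p∣hy = [ (λ p∣y → x≉1 (p∣-diff⇒≈ (≈-trans (≈-sym xy≈x-1) (p∣*ʳ x p∣y)))) ,
                          (λ y≈1 → p∤1 (p∣-resp-≡ (x-[x-1] x)
                                          (≈⇒p∣-diff (≈-trans (≡⇒≈ (sym (ℤP.*-identityʳ x))) (≈-trans (*-congˡ x (≈-sym y≈1)) xy≈x-1))))) ]
                        (p∣h⇒ p∣hy)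
      where
      xy≈x-1 : x * y ≈ x - + 1
      xy≈x-1 = ≈-trans (*-congˡ x y≈τ) xτ≈x-1
      x-[x-1] : ∀ x → x - (x - + 1) ≡ + 1
      x-[x-1] = solve-∀

    ⇒proportional : ∀ {y} → y ≈ x ⊎ (y ≈ σ ⊎ y ≈ τ) → Proportional x y
    ⇒proportional {y} (inj₁ y≈x) =
      (λ p∣hy → p∤hx (≈-trans (h-resp (≈-sym y≈x)) p∣hy)) ,
      p∣-resp-≡ (sym (resultant-factor x y)) (p∣*ˡ (τ-factor y) (p∣*ˡ (σ-factor y) (≈⇒p∣-diff (≈-sym y≈x))))
    ⇒proportional {y} (inj₂ (inj₁ y≈σ)) =
      p∤hσ y≈σ , p∣-resp-≡ (sym (resultant-factor x y)) (p∣*ˡ (τ-factor y) (p∣*ʳ (x - y) (⇒σ-factor y≈σ)))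
    ⇒proportional {y} (inj₂ (inj₂ y≈τ)) =
      p∤hτ y≈τ , p∣-resp-≡ (sym (resultant-factor x y)) (p∣*ʳ ((x - y) * σ-factor y) (⇒τ-factor y≈τ))

    x≈σ⇒fixed : ω * x ≈ + 1 → p∣ (fixedPoly x)
    x≈σ⇒fixed ωx≈1 = p∣-resp-≡ (sym (fixed₁ x)) (≈⇒p∣-diff (≈-sym ωx≈1))

    x≈τ⇒fixed : x * x ≈ x - + 1 → p∣ (fixedPoly x)
    x≈τ⇒fixed xx≈x-1 = p∣-resp-≡ (sym (fixed₂ x)) (≈⇒p∣-diff xx≈x-1)

    σ≈τ⇒fixed : ∀ {y} → ω * y ≈ + 1 → x * y ≈ x - + 1 → p∣ (fixedPoly x)
    σ≈τ⇒fixed {y} ωy≈1 xy≈x-1 = p∣-resp-≡ (sym (fixed₃ x)) (≈⇒p∣-diff (≈-sym ω[x-1]≈x))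
      where
      commute : ∀ ω x y → ω * (x * y) ≡ x * (ω * y)
      commute = solve-∀
      ω[x-1]≈x : ω * (x - + 1) ≈ x
      ω[x-1]≈x = ≈-trans (*-congˡ ω (≈-sym xy≈x-1))
                         (≈-trans (≡⇒≈ (commute ω x y)) (≈-trans (*-congˡ x ωy≈1) (≡⇒≈ (ℤP.*-identityʳ x))))

    fixed⇒x≈σ : p∣ (fixedPoly x) → ω * x ≈ + 1
    fixed⇒x≈σ p∣f = ≈-sym (p∣-diff⇒≈ (p∣-resp-≡ (fixed₁ x) p∣f))

    fixed⇒x≈τ : p∣ (fixedPoly x) → x * x ≈ x - + 1
    fixed⇒x≈τ p∣f = p∣-diff⇒≈ (p∣-resp-≡ (fixed₂ x) p∣f)

    proportional-fixed : p∣ (fixedPoly x) → ∀ {y} → Proportional x y → y ≈ x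
    proportional-fixed p∣f q =
      [ (λ y≈x → y≈x) ,
        [ (λ y≈σ → cancel-≈ p∤ω (≈-trans (≈-trans (*-congˡ ω y≈σ) ωσ≈1) (≈-sym (fixed⇒x≈σ p∣f)))) ,
          (λ y≈τ → cancel-≈ p∤x (≈-trans (≈-trans (*-congˡ x y≈τ) xτ≈x-1) (≈-sym (fixed⇒x≈τ p∣f)))) ] ]
      (proportional⇒ q)

    F : ℤ → ℤ
    F y = χ (h x * h y)

    F-resp : Respects≈ F
    F-resp y≈z = χ-resp (*-congˡ (h x) (h-resp y≈z))

    mainTerm≡ : ∀ y → mainTerm x y ≡ F y * 𝟙 (proportional? x y)
    mainTerm≡ y = mainTermBy-regular (p∣? (h x)) p∤hx (p∣? (h y)) (p∣? (resultant x y)) (χ (h x * h y)) (χ (g x * g y))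

    row-fixed : p∣ (fixedPoly x) → Σₚ (λ y → mainTerm x y) ≡ F x
    row-fixed p∣f =
      trans (Σₚ-cong (λ y → trans (mainTerm≡ y)
                                  (trans (cong (F y *_) (𝟙-iff (proportional? x y) (y ≈? x) (proportional-fixed p∣f)
                                                               (λ y≈x → ⇒proportional (inj₁ y≈x))))
                                         (ℤP.*-comm (F y) ⟦ y ≈ x ⟧))))
            (Σₚ-delta F F-resp x)

    row-generic : ¬ p∣ (fixedPoly x) → Σₚ (λ y → mainTerm x y) ≡ F x + (F σ + F τ)
    row-generic ¬p∣f = begin
        Σₚ (λ y → mainTerm x y)
          ≡⟨ Σₚ-cong (λ y → trans (mainTerm≡ y) (trans (cong (F y *_) (orbit-indicator y))
                                                         (distrib (F y) ⟦ y ≈ x ⟧ ⟦ y ≈ σ ⟧ ⟦ y ≈ τ ⟧))) ⟩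
        Σₚ (λ y → ⟦ y ≈ x ⟧ * F y + (⟦ y ≈ σ ⟧ * F y + ⟦ y ≈ τ ⟧ * F y))
          ≡⟨ Σ-+ p _ _ ⟩
        Σₚ (λ y → ⟦ y ≈ x ⟧ * F y) + Σₚ (λ y → ⟦ y ≈ σ ⟧ * F y + ⟦ y ≈ τ ⟧ * F y)
          ≡⟨ cong₂ _+_ (Σₚ-delta F F-resp x) (trans (Σ-+ p _ _) (cong₂ _+_ (Σₚ-delta F F-resp σ) (Σₚ-delta F F-resp τ))) ⟩
        F x + (F σ + F τ) ∎
      where
      open ≡-Reasoning
      distrib : ∀ f a b c → f * (a + (b + c)) ≡ a * f + (b * f + c * f)
      distrib = solve-∀
      x≉σ : ∀ {y} → y ≈ x → y ≈ σ → ⊥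
      x≉σ y≈x y≈σ = ¬p∣f (x≈σ⇒fixed (≈-trans (*-congˡ ω (≈-trans (≈-sym y≈x) y≈σ)) ωσ≈1))
      x≉τ : ∀ {y} → y ≈ x → y ≈ τ → ⊥
      x≉τ y≈x y≈τ = ¬p∣f (x≈τ⇒fixed (≈-trans (*-congˡ x (≈-trans (≈-sym y≈x) y≈τ)) xτ≈x-1))
      σ≉τ : ∀ {y} → y ≈ σ → y ≈ τ → ⊥
      σ≉τ {y} y≈σ y≈τ = ¬p∣f (σ≈τ⇒fixed {y} (≈-trans (*-congˡ ω y≈σ) ωσ≈1) (≈-trans (*-congˡ x y≈τ) xτ≈x-1))
      x≉σ,τ : ∀ {y} → y ≈ x → y ≈ σ ⊎ y ≈ τ → ⊥
      x≉σ,τ y≈x = [ x≉σ y≈x , x≉τ y≈x ]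
      orbit-indicator : ∀ y → 𝟙 (proportional? x y) ≡ ⟦ y ≈ x ⟧ + (⟦ y ≈ σ ⟧ + ⟦ y ≈ τ ⟧)
      orbit-indicator y =
        trans (𝟙-disjoint (proportional? x y) (y ≈? x) ((y ≈? σ) ⊎-dec (y ≈? τ)) proportional⇒
                          (λ y≈x → ⇒proportional (inj₁ y≈x)) (λ y≈σ,τ → ⇒proportional (inj₂ y≈σ,τ)) x≉σ,τ)
              (cong (_+_ ⟦ y ≈ x ⟧) (𝟙-disjoint ((y ≈? σ) ⊎-dec (y ≈? τ)) (y ≈? σ) (y ≈? τ) (λ q → q) inj₁ inj₂ σ≉τ))

    Fx≡1 : F x ≡ + 1
    Fx≡1 = χ-y² p∤hx

    χhx : χ (h x) ≡ χ x * χ (x - + 1)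
    χhx = trans (cong χ (h-factor x)) (χ-mul x (x - + 1))

    private
      r₁ : ∀ σ ω x → σ - ω * σ ≡ σ * (+ 1 - ω)
      r₁ = solve-∀
      r₂ : ∀ a b c d → (a * b) * (c * (d * a)) ≡ b * ((a * a) * (c * d))
      r₂ = solve-∀
      r₃ : ∀ x x′ → (x - + 1) * x′ - x * x′ ≡ -[1+ 0 ] * x′
      r₃ = solve-∀
      r₄ : ∀ a b m → (a * b) * ((b * a) * (m * a)) ≡ (m * a) * ((a * a) * (b * b))
      r₄ = solve-∀
      r₅ : ∀ x → + 1 - (+ 1 - x) ≡ x
      r₅ = solve-∀

    Fσ≡ : F σ ≡ χ (x - + 1)
    Fσ≡ = begin
      χ (h x * h σ)                                 ≡⟨ χ-mul (h x) (h σ) ⟩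
      χ (h x) * χ (h σ)                             ≡⟨ cong₂ _*_ χhx (trans (cong χ (h-factor σ)) (χ-mul σ (σ - + 1))) ⟩
      (χ x * χ (x - + 1)) * (χ σ * χ (σ - + 1))     ≡⟨ cong (λ w → (χ x * χ (x - + 1)) * (χ σ * w)) χσ-1 ⟩
      (χ x * χ (x - + 1)) * (χ σ * (χ ω * χ x))     ≡⟨ cong (λ w → (χ x * χ (x - + 1)) * (w * (χ ω * χ x))) (χ-inverse ωσ≈1) ⟩
      (χ x * χ (x - + 1)) * (χ ω * (χ ω * χ x))     ≡⟨ r₂ (χ x) (χ (x - + 1)) (χ ω) (χ ω) ⟩
      χ (x - + 1) * ((χ x * χ x) * (χ ω * χ ω))     ≡⟨ cong₂ (λ u v → χ (x - + 1) * (u * v)) (χ²≡1 p∤x) (χ²≡1 p∤ω) ⟩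
      χ (x - + 1) * (+ 1 * + 1)                     ≡⟨ ℤP.*-identityʳ (χ (x - + 1)) ⟩
      χ (x - + 1)                                   ∎
      where
      open ≡-Reasoning
      σ-1≈σx : σ - + 1 ≈ σ * x
      σ-1≈σx = ≈-trans (+-congˡ σ (neg-cong (≈-sym ωσ≈1))) (≈-trans (≡⇒≈ (r₁ σ ω x)) (*-congˡ σ (≡⇒≈ (r₅ x))))
      χσ-1 : χ (σ - + 1) ≡ χ ω * χ x
      χσ-1 = trans (χ-resp σ-1≈σx) (trans (χ-mul σ x) (cong (_* χ x) (χ-inverse ωσ≈1)))

    Fτ≡ : F τ ≡ χ (- x)
    Fτ≡ = begin
      χ (h x * h τ)                                                       ≡⟨ χ-mul (h x) (h τ) ⟩
      χ (h x) * χ (h τ)                                                   ≡⟨ cong₂ _*_ χhx (trans (cong χ (h-factor τ)) (χ-mul τ (τ - + 1))) ⟩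
      (χ x * χ (x - + 1)) * (χ τ * χ (τ - + 1))                           ≡⟨ cong₂ (λ u v → (χ x * χ (x - + 1)) * (u * v)) χτ χτ-1 ⟩
      (χ x * χ (x - + 1)) * ((χ (x - + 1) * χ x) * (χ -[1+ 0 ] * χ x))    ≡⟨ r₄ (χ x) (χ (x - + 1)) (χ -[1+ 0 ]) ⟩
      (χ -[1+ 0 ] * χ x) * ((χ x * χ x) * (χ (x - + 1) * χ (x - + 1)))    ≡⟨ cong₂ (λ u v → (χ -[1+ 0 ] * χ x) * (u * v)) (χ²≡1 p∤x) (χ²≡1 p∤x-1) ⟩
      (χ -[1+ 0 ] * χ x) * (+ 1 * + 1)                                    ≡⟨ ℤP.*-identityʳ _ ⟩
      χ -[1+ 0 ] * χ x                                                    ≡⟨ sym (χ-mul -[1+ 0 ] x) ⟩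
      χ (-[1+ 0 ] * x)                                                    ≡⟨ cong χ (ℤP.-1*i≡-i x) ⟩
      χ (- x)                                                             ∎
      where
      open ≡-Reasoning
      χτ : χ τ ≡ χ (x - + 1) * χ x
      χτ = trans (χ-mul (x - + 1) x′) (cong (χ (x - + 1) *_) (χ-inverse xx′≈1))
      τ-1≈-x′ : τ - + 1 ≈ -[1+ 0 ] * x′
      τ-1≈-x′ = ≈-trans (+-congˡ τ (neg-cong (≈-sym xx′≈1))) (≡⇒≈ (r₃ x x′))
      χτ-1 : χ (τ - + 1) ≡ χ -[1+ 0 ] * χ x
      χτ-1 = trans (χ-resp τ-1≈-x′) (trans (χ-mul -[1+ 0 ] x′) (cong (χ -[1+ 0 ] *_) (χ-inverse xx′≈1)))

  fixed-roots : ∀ {x r} → p∣ (fixedPoly r) → p∣ (fixedPoly x) → x ≈ r ⊎ x ≈ + 1 - r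
  fixed-roots {x} {r} p∣fr p∣fx =
    ⊎-map (p∣-diff⇒≈ {x} {r}) (p∣-diff⇒≈ {x} {+ 1 - r})
          (euclid (p∣-resp-≡ (difference x r) (≈⇒p∣-diff (≈-trans p∣fx (≈-sym p∣fr)))))
    where
    difference : ∀ x r → (x * x - x + + 1) - (r * r - r + + 1) ≡ (x - r) * (x - (+ 1 - r))
    difference = solve-∀

  fixed-count : Σₚ (λ x → ⟦ fixedPoly x ≈ + 0 ⟧) ≤ + 2
  fixed-count with ℕP.anyUpTo? (λ r → p∣? (fixedPoly (+ r))) p
  ... | yes (r , _ , p∣fr) =
    ℤP.≤-trans (Σ-mono-≤ p {g = λ x → ⟦ + x ≈ + r ⟧ + ⟦ + x ≈ + 1 - + r ⟧}
                         (λ x _ → 𝟙-cover (fixedPoly (+ x) ≈? + 0) (+ x ≈? + r) (+ x ≈? + 1 - + r) (fixed-roots p∣fr)))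
               (ℤP.≤-reflexive (trans (Σ-+ p _ _) (cong₂ _+_ (class-size (+ r)) (class-size (+ 1 - + r)))))
  ... | no no-root =
    ℤP.≤-trans (ℤP.≤-reflexive (trans (Σ-cong p (λ x x<p → 𝟙-no (fixedPoly (+ x) ≈? + 0) (λ p∣fx → no-root (x , x<p , p∣fx))))
                                      (Σ-zero p)))
               (ℤ.+≤+ ℕ.z≤n)

  degenerate-count : Σₚ (λ y → 𝟙 (p∣? (h y))) ≤ + 2
  degenerate-count =
    ℤP.≤-trans (Σ-mono-≤ p {g = λ y → ⟦ + y ≈ + 0 ⟧ + ⟦ + y ≈ + 1 ⟧} (λ y _ → 𝟙-cover (p∣? (h (+ y))) (+ y ≈? + 0) (+ y ≈? + 1) p∣h⇒))
               (ℤP.≤-reflexive (trans (Σ-+ p _ _) (cong₂ _+_ (class-size (+ 0)) (class-size (+ 1)))))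

  rowSum : ℤ → ℤ
  rowSum x = Σₚ (λ y → mainTerm x y)

  rowShape : ℤ → ℤ
  rowShape x = χ (x - + 1) + χ (- x)

  rowError : ℤ → ℤ
  rowError x = rowSum x - + 1 - rowShape x

  exceptional : ℤ → ℤ
  exceptional x = ⟦ x ≈ + 0 ⟧ + ⟦ x ≈ + 1 ⟧ + ⟦ fixedPoly x ≈ + 0 ⟧

  Within : ℤ → ℤ → Set
  Within c e = (- c ≤ e) × (e ≤ c)

  exceptional≥0 : ∀ x → + 0 ≤ exceptional x
  exceptional≥0 x = ℤP.+-mono-≤ (ℤP.+-mono-≤ (𝟙≥0 (x ≈? + 0)) (𝟙≥0 (x ≈? + 1))) (𝟙≥0 (fixedPoly x ≈? + 0))

  exceptional≥1 : ∀ x → p∣ x ⊎ (x ≈ + 1 ⊎ p∣ (fixedPoly x)) → + 1 ≤ exceptional x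
  exceptional≥1 x which = ℤP.≤-trans (one≤ which) (ℤP.≤-reflexive (sym (regroup ⟦ x ≈ + 0 ⟧ ⟦ x ≈ + 1 ⟧ ⟦ fixedPoly x ≈ + 0 ⟧)))
    where
    regroup : ∀ a b c → a + b + c ≡ a + (b + c)
    regroup = solve-∀
    one≤ : p∣ x ⊎ (x ≈ + 1 ⊎ p∣ (fixedPoly x)) → + 1 ≤ ⟦ x ≈ + 0 ⟧ + (⟦ x ≈ + 1 ⟧ + ⟦ fixedPoly x ≈ + 0 ⟧)
    one≤ (inj₁ p∣x) = subst (λ w → + 1 ≤ w + (⟦ x ≈ + 1 ⟧ + ⟦ fixedPoly x ≈ + 0 ⟧)) (sym (𝟙-yes (x ≈? + 0) p∣x))
      (ℤP.+-mono-≤ (ℤP.≤-refl {+ 1}) (ℤP.+-mono-≤ (𝟙≥0 (x ≈? + 1)) (𝟙≥0 (fixedPoly x ≈? + 0))))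
    one≤ (inj₂ (inj₁ x≈1)) = subst (λ w → + 1 ≤ ⟦ x ≈ + 0 ⟧ + (w + ⟦ fixedPoly x ≈ + 0 ⟧)) (sym (𝟙-yes (x ≈? + 1) x≈1))
      (ℤP.+-mono-≤ (𝟙≥0 (x ≈? + 0)) (ℤP.+-mono-≤ (ℤP.≤-refl {+ 1}) (𝟙≥0 (fixedPoly x ≈? + 0))))
    one≤ (inj₂ (inj₂ p∣f)) = subst (λ w → + 1 ≤ ⟦ x ≈ + 0 ⟧ + (⟦ x ≈ + 1 ⟧ + w)) (sym (𝟙-yes (fixedPoly x ≈? + 0) p∣f))
      (ℤP.+-mono-≤ (𝟙≥0 (x ≈? + 0)) (ℤP.+-mono-≤ (𝟙≥0 (x ≈? + 1)) (ℤP.≤-refl {+ 1})))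

  rowShape-within : ∀ x → Within (+ 2) (rowShape x)
  rowShape-within x = ℤP.+-mono-≤ (-1≤χ (x - + 1)) (-1≤χ (- x)) , ℤP.+-mono-≤ (χ≤1 (x - + 1)) (χ≤1 (- x))

  rowError-within : ∀ x → Within (+ 2) (rowSum x) → Within (+ 5) (rowError x)
  rowError-within x (lo , hi) =
    ℤP.+-mono-≤ (ℤP.+-mono-≤ lo (ℤP.≤-refl { -[1+ 0 ]})) (ℤP.neg-mono-≤ (proj₂ (rowShape-within x))) ,
    ℤP.≤-trans (ℤP.+-mono-≤ (ℤP.+-mono-≤ hi (ℤP.≤-refl { -[1+ 0 ]})) (ℤP.neg-mono-≤ (proj₁ (rowShape-within x))))
               (ℤ.+≤+ (ℕ.s≤s (ℕ.s≤s (ℕ.s≤s ℕ.z≤n))))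

  RowErrorBound : ℤ → Set
  RowErrorBound x = Within (+ 5 * exceptional x) (rowError x)

  bound-exceptional : ∀ x → Within (+ 5) (rowError x) → + 1 ≤ exceptional x → RowErrorBound x
  bound-exceptional x (lo , hi) one≤ =
    ℤP.≤-trans (ℤP.neg-mono-≤ (ℤP.*-monoˡ-≤-nonNeg (+ 5) one≤)) lo , ℤP.≤-trans hi (ℤP.*-monoˡ-≤-nonNeg (+ 5) one≤)

  bound-zero : ∀ x → rowError x ≡ + 0 → RowErrorBound x
  bound-zero x err≡0 =
    subst (- (+ 5 * exceptional x) ≤_) (sym err≡0) (ℤP.neg-mono-≤ (ℤP.*-monoˡ-≤-nonNeg (+ 5) (exceptional≥0 x))) ,
    subst (_≤ + 5 * exceptional x) (sym err≡0) (ℤP.*-monoˡ-≤-nonNeg (+ 5) (exceptional≥0 x))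

  -- A degenerate row (h x ≡ 0) only sees the at most two degenerate y, each with weight ± 1.
  degenerate-row : ∀ x → p∣ (h x) → Within (+ 2) (rowSum x)
  degenerate-row x p∣hx =
    ℤP.≤-trans (ℤP.neg-mono-≤ degenerate-count)
      (ℤP.≤-trans (ℤP.≤-reflexive (sym (Σ-neg p (λ y → 𝟙 (p∣? (h (+ y)))))))
                  (Σ-mono-≤ p (λ y _ → subst (- 𝟙 (p∣? (h (+ y))) ≤_) (sym (entry (+ y))) (proj₁ (scaled (+ y)))))) ,
    ℤP.≤-trans (Σ-mono-≤ p {g = λ y → 𝟙 (p∣? (h (+ y)))} (λ y _ → subst (_≤ 𝟙 (p∣? (h (+ y)))) (sym (entry (+ y))) (proj₂ (scaled (+ y)))))
               degenerate-count
    where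
    entry : ∀ y → mainTerm x y ≡ χ (g x * g y) * 𝟙 (p∣? (h y))
    entry y = mainTermBy-degenerate (p∣? (h x)) p∣hx (p∣? (h y)) (p∣? (resultant x y)) (χ (h x * h y)) (χ (g x * g y))
    scaled : ∀ y → (- 𝟙 (p∣? (h y)) ≤ χ (g x * g y) * 𝟙 (p∣? (h y))) × (χ (g x * g y) * 𝟙 (p∣? (h y)) ≤ 𝟙 (p∣? (h y)))
    scaled y = 𝟙-scaled (χ (g x * g y)) (p∣? (h y)) (-1≤χ _) (χ≤1 _)

  rowError-bound : ∀ x → RowErrorBound x
  rowError-bound x = by-degeneracy (p∣? (h x))
    where
    cancel : ∀ a b → (+ 1 + (a + b)) - + 1 - (a + b) ≡ + 0
    cancel = solve-∀
    regular-row : ¬ p∣ (h x) → Dec (p∣ (fixedPoly x)) → RowErrorBound x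
    regular-row p∤hx (yes p∣f) =
      bound-exceptional x (rowError-within x (subst (Within (+ 2)) (sym row≡1) (ℤ.-≤+ , ℤ.+≤+ (ℕ.s≤s ℕ.z≤n))))
                        (exceptional≥1 x (inj₂ (inj₂ p∣f)))
      where
      open RegularRow x p∤hx
      row≡1 : rowSum x ≡ + 1
      row≡1 = trans (row-fixed p∣f) Fx≡1
    regular-row p∤hx (no ¬p∣f) =
      bound-zero x (trans (cong (λ s → s - + 1 - rowShape x) row≡) (cancel (χ (x - + 1)) (χ (- x))))
      where
      open RegularRow x p∤hx
      row≡ : rowSum x ≡ + 1 + (χ (x - + 1) + χ (- x))
      row≡ = trans (row-generic ¬p∣f) (cong₂ _+_ Fx≡1 (cong₂ _+_ Fσ≡ Fτ≡))
    by-degeneracy : Dec (p∣ (h x)) → RowErrorBound x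
    by-degeneracy (yes p∣hx) = bound-exceptional x (rowError-within x (degenerate-row x p∣hx))
                                                 (exceptional≥1 x (⊎-map (λ q → q) inj₁ (p∣h⇒ p∣hx)))
    by-degeneracy (no p∤hx)  = regular-row p∤hx (p∣? (fixedPoly x))

  ΣrowShape : Σₚ rowShape ≡ + 0
  ΣrowShape = trans (Σ-+ p (λ x → χ (+ x - + 1)) (λ x → χ (- + x))) (cong₂ _+_ shifted negated)
    where
    shifted : Σₚ (λ x → χ (x - + 1)) ≡ + 0
    shifted = trans (Σₚ-cong (λ x → cong χ (cong (_- + 1) (sym (ℤP.*-identityˡ x)))))
                    (trans (reindex-unit (+ 1) -[1+ 0 ] p∤1 χ χ-resp) Σχ≡0)
    negated : Σₚ (λ x → χ (- x)) ≡ + 0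
    negated = trans (Σₚ-cong (λ x → cong χ (sym (trans (ℤP.+-identityʳ (-[1+ 0 ] * x)) (ℤP.-1*i≡-i x)))))
                    (trans (reindex-unit -[1+ 0 ] (+ 0) p∤-1 χ χ-resp) Σχ≡0)

  Σexceptional : Σₚ exceptional ≤ + 4
  Σexceptional = ℤP.≤-trans (ℤP.≤-reflexive (trans (Σ-+ p _ _) (cong (_+ Σₚ (λ x → ⟦ fixedPoly x ≈ + 0 ⟧))
                                                              (trans (Σ-+ p _ _) (cong₂ _+_ (class-size (+ 0)) (class-size (+ 1)))))))
                            (ℤP.+-mono-≤ (ℤP.≤-refl {+ 2}) fixed-count)

  totalError : ℤ
  totalError = Σₚ rowError

  mainTotal≡ : mainTotal ≡ + p + totalError
  mainTotal≡ = begin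
    mainTotal                                     ≡⟨ Σₚ-cong (λ x → split (rowSum x) (rowShape x)) ⟩
    Σₚ (λ x → + 1 + rowShape x + rowError x)      ≡⟨ Σ-+ p _ _ ⟩
    Σₚ (λ x → + 1 + rowShape x) + totalError       ≡⟨ cong (_+ totalError) (trans (Σ-+ p _ _) (cong₂ _+_ (Σ-one p) ΣrowShape)) ⟩
    + p + + 0 + totalError                         ≡⟨ cong (_+ totalError) (ℤP.+-identityʳ (+ p)) ⟩
    + p + totalError                               ∎
    where
    open ≡-Reasoning
    split : ∀ s e → s ≡ + 1 + e + (s - + 1 - e)
    split = solve-∀

  totalError-within : Within (+ 20) totalError
  totalError-within =
    ℤP.≤-trans (ℤP.neg-mono-≤ (ℤP.*-monoˡ-≤-nonNeg (+ 5) Σexceptional))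
      (ℤP.≤-trans (ℤP.≤-reflexive (sym (trans (Σ-neg p _) (cong -_ (Σ-*ˡ p (+ 5) (λ x → exceptional (+ x)))))))
                  (Σ-mono-≤ p (λ x _ → proj₁ (rowError-bound (+ x))))) ,
    ℤP.≤-trans (Σ-mono-≤ p (λ x _ → proj₂ (rowError-bound (+ x))))
      (ℤP.≤-trans (ℤP.≤-reflexive (Σ-*ˡ p (+ 5) (λ x → exceptional (+ x)))) (ℤP.*-monoˡ-≤-nonNeg (+ 5) Σexceptional))

  ∣totalError∣≤20 : ℤ.∣ totalError ∣ ℕ.≤ 20
  ∣totalError∣≤20 = abs-within totalError totalError-within
    where
    abs-within : ∀ e → Within (+ 20) e → ℤ.∣ e ∣ ℕ.≤ 20
    abs-within (+ n)    (_ , ℤ.+≤+ n≤20)   = n≤20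
    abs-within -[1+ n ] (ℤ.-≤- n≤19 , _)   = ℕ.s≤s n≤19

  secondMoment-expansion : secondMoment ≡ -[1+ 0 ] + + p * (+ p + totalError)
  secondMoment-expansion = trans secondMoment≡ (cong (λ m → -[1+ 0 ] + + p * m) mainTotal≡)

lemma3p3 : ∃ λ (C : ℚ) → ∀ (p : ℕ) → Prime p → 2 ℕ.< p →
    ℚ.∣ Q p ℚ.+ 1ℚ ∣ ℚ.* ((+ p) / 1) ℚ.≤ C
lemma3p3 = (+ 21) / 1 , bound
  where
  bound : ∀ (p : ℕ) → Prime p → 2 ℕ.< p → ℚ.∣ Q p ℚ.+ 1ℚ ∣ ℚ.* ((+ p) / 1) ℚ.≤ (+ 21) / 1
  bound (suc k) isPrime p>2 =
    subst (λ S → ℚ.∣ ℚ.- (S / (suc k ℕ.* suc k)) ℚ.+ 1ℚ ∣ ℚ.* ((+ suc k) / 1) ℚ.≤ (+ 21) / 1)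
          (sym sum-of-squares≡)
          (deviation-bound k secondMoment totalError 20 secondMoment-expansion ∣totalError∣≤20)
    where open OddPrime k isPrime p>2
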